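{- (a) Let $\gamma=g_1*\dots*g_s\in\Gamma$ with $s\ge1$. Then $\theta(\gamma)=f_{\varepsilon(c(\gamma))}$. (b) A number $n\in\mathbb{N}$ is essential if and only if either $n=0$, or $\mu_1(n)$ is odd and $\mu_1(n)\ge3$. (c) A number $n\in\mathbb{N}$ is essential if and only if $n=\lfloor m\tau\rfloor+\lfloor m\tau^2\rfloor$ for some $m\in\mathbb{N}$, where $\tau=(1+\sqrt5)/2$.
   Context: Let $f_0=f_1=1$, $f_i=f_{i-1}+f_{i-2}$ ($i\ge2$); for a finite set $I$ of positive integers let $f_I=\sum_{i\in I}f_i$. A 2-partition is a finite set of positive integers with consecutive differences $\ge2$; $Z(n)=\{\mu_1(n)<\dots<\mu_q(n)\}$ is the unique 2-partition with $n=f_{Z(n)}$ (Zeckendorf). The canonical form of a nonempty 2-partition is its decomposition into maximal runs $I_1,\dots,I_s$ of consecutive elements of equal parity. The associated vector of $\{i_1<\dots<i_q\}$ is $(\alpha_1,\dots,\alpha_q)$, $\alpha_1=\lfloor(i_1-1)/2\rfloor+1$, $\alpha_r=\lfloor(i_r-i_{r-1})/2\rfloor+1$; cutting it into consecutive blocks of lengths $|I_1|,\dots,|I_s|$ gives $\mathcal{V}(I)=B_1\times\cdots\times B_s$. Define integers $D(\emptyset)=1$, $D(\alpha_1)=\alpha_1$, $D(\alpha_1,\dots,\alpha_r)=\alpha_rD(\alpha_1,\dots,\alpha_{r-1})-D(\alpha_1,\dots,\alpha_{r-2})$. Let $\mathcal{A}_1$ be the set of integer vectors $(\alpha_1,\dots,\alpha_q)$,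 $q\ge1$, with $\alpha_1\ge1$, $\alpha_2,\dots,\alpha_q\ge2$; for $B=(\beta_1,\dots,\beta_q)\in\mathcal{A}_1$ let $\langle B\rangle=D(\beta_2,\dots,\beta_q)/D(\beta_1,\dots,\beta_q)>0$. For each rational $g>0$ there is a unique $c(g)\in\mathcal{A}_1$ with $\langle c(g)\rangle=g$. Let $\Gamma$ be the free monoid generated by the nonzero elements of $\mathbb{Q}/\mathbb{Z}$, each identified with its representative fraction in $(0,1)$; its elements are words $g_1*\dots*g_s$ ($s\ge0$). For $\gamma=g_1*\dots*g_s$ put $c(\gamma)=c(g_1)\times\dots\times c(g_s)$ (a tuple of vectors). Define $\pi:\mathbb{N}\to\Gamma$ by $\pi(0)=$ unit and, for $n\ge1$ with $\mathcal{V}(Z(n))=B_1\times\cdots\times B_s$, $\pi(n)=\overline{\langle B_1\rangle}*\langle B_2\rangle*\cdots*\langle B_s\rangle$, where $\overline{\langle B_1\rangle}$ is the class of $\langle B_1\rangle$ in $\mathbb{Q}/\mathbb{Z}$ (omitted if $0$). $\pi$ is surjective; for $\gamma\in\Gamma$, $\theta(\gamma)$ is the smallest element of $\pi^{ -1}(\gamma)$. A number $n$ is essential if $n=\theta(\pi(n))$. For a vector $B=(\beta_1,\dots,\beta_q)$ let $d(B)=\beta_1+\dots+\beta_q-q$ and $\varepsilon(B)=\{2d(\beta_1)+1,2d(\beta_1,\beta_2)+1,\dots,2d(\beta_1,\dots,\beta_q)+1\}$. Let $\sigma^m$ add $m$ to every element of a set. For $B_1\times\dots\times B_s$ put $\varepsilon(B_1\times\dots\times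 B_s)=\varepsilon(B_1)\cup\sigma^{2d(B_1)+1}(\varepsilon(B_2))\cup\dots\cup\sigma^{2d(B_1)+\dots+2d(B_{s-1})+s-1}(\varepsilon(B_s))$. -}

module Defs where

open import Data.Nat as ℕ using (ℕ; zero; suc; _+_; _*_; _∸_; _≤_; _<_; _/_; _%_; _≡ᵇ_)
open import Data.Integer as ℤ using (ℤ; +_; -[1+_])
open import Data.Rational as ℚ using (ℚ; 0ℚ; floor)
open import Data.Nat.ListAction using (sum)
open import Data.List using (List; []; _∷_; [_]; map; length; take; reverse; _++_; zip; upTo)
open import Data.List.Relation.Unary.All using (All)
open import Data.List.Relation.Unary.Linked using (Linked)
open import Data.Product using (Σ; _×_; _,_; proj₂; ∃)
open import Data.Unit using (⊤)
open import Data.Bool using (if_then_else_)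
open import Relation.Nullary using (¬_; does)
open import Relation.Binary.PropositionalEquality using (_≡_)

fib : ℕ → ℕ
fib zero = 1
fib (suc zero) = 1
fib (suc (suc n)) = fib (suc n) + fib n

-- f_I for a finite set I given as a list (of distinct elements)
fsum : List ℕ → ℕ
fsum I = sum (map fib I)

TwoPartition : List ℕ → Set
TwoPartition I = All (1 ≤_) I × Linked (λ i j → i + 2 ≤ j) I

IsZ : ℕ → List ℕ → Set
IsZ n I = TwoPartition I × fsum I ≡ n

-- μ₁(n) = i  (the least element of Z(n))
IsMu1 : ℕ → ℕ → Set
IsMu1 n i = Σ (List ℕ) λ I → IsZ n (i ∷ I)

assocVecFrom : ℕ → List ℕ → List ℕ
assocVecFrom prev [] = []
assocVecFrom prev (i ∷ is) = ((i ∸ prev) / 2 + 1) ∷ assocVecFrom i is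

assocVec : List ℕ → List ℕ
assocVec = assocVecFrom 1

sameParity : ℕ → ℕ → Data.Bool.Bool
sameParity i j = (i % 2) ≡ᵇ (j % 2)

runsAcc : ℕ → List ℕ → List (ℕ × ℕ) → List (List ℕ)
runsAcc p cur [] = [ reverse cur ]
runsAcc p cur ((i , a) ∷ xs) =
  if sameParity p i then runsAcc p (a ∷ cur) xs
  else reverse cur ∷ runsAcc i [ a ] xs

runs : List (ℕ × ℕ) → List (List ℕ)
runs [] = []
runs ((i , a) ∷ xs) = runsAcc i [ a ] xs

𝒱 : List ℕ → List (List ℕ)
𝒱 I = runs (zip I (assocVec I))

-- D(α₁,…,α_r), recursion on the last index (computed on the reversed list)
Drev : List ℕ → ℤ
Drev [] = + 1
Drev (a ∷ []) = + a
Drev (a ∷ b ∷ r) = (+ a) ℤ.* Drev (b ∷ r) ℤ.- Drev r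

D : List ℕ → ℤ
D xs = Drev (reverse xs)

-- the rational number n/d (d ≠ 0); junk value 0 when d = 0
frac : ℤ → ℤ → ℚ
frac n (+ zero) = 0ℚ
frac n (+ (suc d)) = n ℚ./ suc d
frac n (-[1+ d ]) = (ℤ.- n) ℚ./ suc d

tail : List ℕ → List ℕ
tail [] = []
tail (_ ∷ xs) = xs

⟨_⟩ : List ℕ → ℚ
⟨ B ⟩ = frac (D (tail B)) (D B)

𝒜₁ : List ℕ → Set
𝒜₁ [] = Data.Empty.⊥
  where import Data.Empty
𝒜₁ (a ∷ as) = 1 ≤ a × All (2 ≤_) as

-- Γ: words in the nonzero elements of ℚ/ℤ, each represented by its
-- representative in (0,1).  The unit is the empty word.
Γ : Set
Γ = List ℚ

InUnitInterval : ℚ → Set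
InUnitInterval g = 0ℚ ℚ.< g × g ℚ.< ℚ.1ℚ

classQZ : ℚ → ℚ
classQZ p = p ℚ.- (floor p ℚ./ 1)

consClass : ℚ → Γ → Γ
consClass p γ = if does (classQZ p ℚ.≟ 0ℚ) then γ else classQZ p ∷ γ

piOfBlocks : List (List ℕ) → Γ
piOfBlocks [] = []
piOfBlocks (B₁ ∷ Bs) = consClass ⟨ B₁ ⟩ (map ⟨_⟩ Bs)

-- graph of π : ℕ → Γ   (π(0) = unit, since Z(0) = ∅)
IsPi : ℕ → Γ → Set
IsPi n γ = Σ (List ℕ) λ I → IsZ n I × piOfBlocks (𝒱 I) ≡ γ

IsTheta : Γ → ℕ → Set
IsTheta γ m = IsPi m γ × (∀ k → k < m → ¬ IsPi k γ)

-- n essential : n = θ(π(n))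
Essential : ℕ → Set
Essential n = ∀ γ → IsPi n γ → IsTheta γ n

d : List ℕ → ℕ
d B = sum B ∸ length B

εB : List ℕ → List ℕ
εB B = map (λ k → 2 * d (take (suc k) B) + 1) (upTo (length B))

-- ε(B₁ × ⋯ × B_s), with σ^m adding m to every element
εFrom : ℕ → List (List ℕ) → List ℕ
εFrom shift [] = []
εFrom shift (B ∷ Bs) = map (λ x → shift + x) (εB B) ++ εFrom (shift + 2 * d B + 1) Bs

ε : List (List ℕ) → List ℕ
ε = εFrom 0

-- Comparisons of natural numbers with reals of the form (p + q√5)/2,
-- p, q ∈ ℕ, written out exactly (√5 irrational, so these are exact).
-- a ≤ (p + q√5)/2  ⇔  2a − p ≤ q√5
LeHalfSqrt5 : ℕ → ℕ → ℕ → Set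
LeHalfSqrt5 a p q = (2 * a ≤ p) Data.Sum.⊎ ((2 * a ∸ p) * (2 * a ∸ p) ≤ 5 * (q * q))
  where import Data.Sum

-- (p + q√5)/2 < b  ⇔  q√5 < 2b − p
LtHalfSqrt5 : ℕ → ℕ → ℕ → Set
LtHalfSqrt5 p q b = (p < 2 * b) × (5 * (q * q) < (2 * b ∸ p) * (2 * b ∸ p))

IsFloorHalfSqrt5 : ℕ → ℕ → ℕ → Set
IsFloorHalfSqrt5 p q a = LeHalfSqrt5 a p q × LtHalfSqrt5 p q (suc a)

-- m τ = (m + m√5)/2,  m τ² = (3m + m√5)/2
IsFloorMulTau : ℕ → ℕ → Set
IsFloorMulTau m a = IsFloorHalfSqrt5 m m a

IsFloorMulTau² : ℕ → ℕ → Set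
IsFloorMulTau² m a = IsFloorHalfSqrt5 (3 * m) m a

-- If the least element of Z(n) is even,
-- shifting Z(n) down by one keeps 𝒱; if it is 1, dropping it (and, when the next
-- element is odd, shifting the rest down by two) changes ⟨B₁⟩ only by an integer.
-- Either way a smaller number has the same image under π, so a minimal preimage has
-- odd least element ≥ 3.  On such sets ε inverts 𝒱, and B ↦ ⟨B⟩ is injective on 𝒜₁
-- (a quotient of continuants determines its negative continued fraction), which
-- gives (a) and (b).  For (c) write Z(n) = 3 + J, where J has even least element:
-- then n = a + (a + m) with m = Σ f j and a = Σ f (j + 1) over j ∈ J.  Peeling J
-- from below while tracking the signs of c + dτ with integer certificates shows
-- a = ⌊mτ⌋, and ⌊mτ²⌋ = ⌊mτ⌋ + m.
module Submission where

open import Defs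

module Zeckendorf where

  open import Data.Nat using (ℕ; zero; suc; _+_; _∸_; _≤_; _<_; z≤n; s≤s; _<?_; >-nonZero)
  open import Data.Nat.Properties
  open import Data.List using (List; []; _∷_; [_]; _++_; map)
  open import Data.List.Relation.Unary.All as All using (All; []; _∷_)
  import Data.List.Relation.Unary.All.Properties as All
  open import Data.List.Relation.Unary.Linked as Linked using (Linked; []; [-]; _∷_)
  open import Data.List.Relation.Unary.Linked.Properties using (Linked⇒All; map⁺)
  open import Data.Product using (Σ; _×_; _,_)
  open import Data.Sum using (_⊎_; inj₁; inj₂)
  open import Data.Empty using (⊥-elim)
  open import Relation.Nullary using (Dec; yes; no)
  open import Relation.Binary.PropositionalEquality hiding ([_])

  Gap : ℕ → ℕ → Set
  Gap i j = i + 2 ≤ j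

  fsum-++ : ∀ xs ys → fsum (xs ++ ys) ≡ fsum xs + fsum ys
  fsum-++ [] ys = refl
  fsum-++ (x ∷ xs) ys = trans (cong (fib x +_) (fsum-++ xs ys)) (sym (+-assoc (fib x) (fsum xs) (fsum ys)))

  1≤fib : ∀ i → 1 ≤ fib i
  1≤fib zero = s≤s z≤n
  1≤fib (suc zero) = s≤s z≤n
  1≤fib (suc (suc i)) = ≤-trans (1≤fib (suc i)) (m≤m+n _ _)

  fib-mono-≤ : ∀ {i j} → i ≤ j → fib i ≤ fib j
  fib-mono-≤ {j = j} z≤n = ≤-trans (1≤fib 0) (1≤fib j)
  fib-mono-≤ (s≤s {zero} {zero} z≤n) = ≤-refl
  fib-mono-≤ (s≤s {zero} {suc j} z≤n) = ≤-trans (fib-mono-≤ (s≤s (z≤n {j}))) (m≤m+n _ _)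
  fib-mono-≤ (s≤s {suc i} {suc j} i≤j) = +-mono-≤ (fib-mono-≤ i≤j) (fib-mono-≤ (≤-pred i≤j))

  fib-suc-< : ∀ i → fib (suc i) < fib (suc (suc i))
  fib-suc-< i = subst (_≤ fib (suc i) + fib i) (+-comm (fib (suc i)) 1) (+-monoʳ-≤ (fib (suc i)) (1≤fib i))

  n≤fib : ∀ n → n ≤ fib n
  n≤fib zero = z≤n
  n≤fib (suc zero) = s≤s z≤n
  n≤fib (suc (suc n)) = subst (_≤ fib (suc (suc n))) (+-comm (suc n) 1) (+-mono-≤ (n≤fib (suc n)) (1≤fib n))

  fib≤fsum : ∀ I → All (λ i → fib i ≤ fsum I) I
  fib≤fsum [] = []
  fib≤fsum (i ∷ I) = m≤m+n _ _ ∷ All.map (λ p → ≤-trans p (m≤n+m _ (fib i))) (fib≤fsum I)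

  Linked-++-gap : ∀ {xs h ys} → Linked Gap xs → All (λ x → x + 2 ≤ h) xs → Linked Gap (h ∷ ys) → Linked Gap (xs ++ h ∷ ys)
  Linked-++-gap {[]} _ _ L = L
  Linked-++-gap {x ∷ []} _ (p ∷ []) L = p ∷ L
  Linked-++-gap {x ∷ y ∷ xs} (r ∷ Lxs) (_ ∷ ps) L = r ∷ Linked-++-gap Lxs ps L

  Linked-++⁻ˡ : ∀ {xs ys} → Linked Gap (xs ++ ys) → Linked Gap xs
  Linked-++⁻ˡ {[]} _ = []
  Linked-++⁻ˡ {x ∷ []} _ = [-]
  Linked-++⁻ˡ {x ∷ y ∷ xs} (r ∷ L) = r ∷ Linked-++⁻ˡ {y ∷ xs} L

  TwoPartition-tail : ∀ {x xs} → TwoPartition (x ∷ xs) → TwoPartition xs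
  TwoPartition-tail (_ ∷ pos , L) = pos , Linked.tail L

  TwoPartition-++⁻ˡ : ∀ {xs ys} → TwoPartition (xs ++ ys) → TwoPartition xs
  TwoPartition-++⁻ˡ {xs} (pos , L) = All.++⁻ˡ xs pos , Linked-++⁻ˡ L

  Gap-trans : ∀ {i j k} → Gap i j → Gap j k → Gap i k
  Gap-trans {i} {j} p q = ≤-trans p (≤-trans (m≤m+n j 2) q)

  Linked-gap-All : ∀ {x xs} → Linked Gap (x ∷ xs) → All (λ y → x + 2 ≤ y) xs
  Linked-gap-All [-] = []
  Linked-gap-All (r ∷ L) = Linked⇒All Gap-trans r L

  Linked-gap-lower-bound : ∀ {c x xs} → c ≤ x + 2 → Linked Gap (x ∷ xs) → All (c ≤_) xs
  Linked-gap-lower-bound c≤ L = All.map (≤-trans c≤) (Linked-gap-All L)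

  Linked-gap-map-+ : ∀ c {J} → Linked Gap J → Linked Gap (map (c +_) J)
  Linked-gap-map-+ c L = map⁺ (Linked.map (λ {x} {y} p → subst (_≤ c + y) (sym (+-assoc c x 2)) (+-monoʳ-≤ c p)) L)

  Linked-gap-map-∸ : ∀ c {J} → All (c ≤_) J → Linked Gap J → Linked Gap (map (_∸ c) J)
  Linked-gap-map-∸ c [] [] = []
  Linked-gap-map-∸ c (_ ∷ []) [-] = [-]
  Linked-gap-map-∸ c {i ∷ j ∷ J} (p ∷ q ∷ ps) (r ∷ L) =
    subst (_≤ j ∸ c) (+-∸-comm 2 p) (∸-monoˡ-≤ c r) ∷ Linked-gap-map-∸ c (q ∷ ps) L

  map-+-∸ : ∀ c J → All (c ≤_) J → map (c +_) (map (_∸ c) J) ≡ J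
  map-+-∸ c [] _ = refl
  map-+-∸ c (j ∷ J) (p ∷ ps) = cong₂ _∷_ (m+[n∸m]≡n p) (map-+-∸ c J ps)

  fsum-map-∸ : ∀ c I → fsum (map (_∸ c) I) ≤ fsum I
  fsum-map-∸ c [] = z≤n
  fsum-map-∸ c (i ∷ I) = +-mono-≤ (fib-mono-≤ (m∸n≤m i c)) (fsum-map-∸ c I)

  ZeckendorfBelow : ℕ → ℕ → Set
  ZeckendorfBelow k n = Σ (List ℕ) λ I → IsZ n I × All (_< k) I

  zeckendorf-add-fib : ∀ k n → fib (suc k) ≤ n → ZeckendorfBelow k (n ∸ fib (suc k)) → ZeckendorfBelow (suc (suc k)) n
  zeckendorf-add-fib k n f≤n (J , ((posJ , LJ) , sumJ) , J<k) =
    J ++ [ suc k ] ,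
    ((All.++⁺ posJ (s≤s z≤n ∷ []) , Linked-++-gap LJ (All.map (λ {x} x<k → subst (_≤ suc k) (+-comm 2 x) (s≤s x<k)) J<k) [-]) , sum≡) ,
    All.++⁺ (All.map (λ x<k → m<n⇒m<1+n (m<n⇒m<1+n x<k)) J<k) (n<1+n _ ∷ [])
    where
    sum≡ : fsum (J ++ [ suc k ]) ≡ n
    sum≡ = begin
      fsum (J ++ [ suc k ])         ≡⟨ fsum-++ J [ suc k ] ⟩
      fsum J + (fib (suc k) + 0)    ≡⟨ cong₂ _+_ sumJ (+-identityʳ _) ⟩
      n ∸ fib (suc k) + fib (suc k) ≡⟨ m∸n+n≡m f≤n ⟩
      n ∎
      where open ≡-Reasoning

  zeckendorf-below : ∀ k n → n < fib k → ZeckendorfBelow k n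
  zeckendorf-below zero zero _ = [] , (([] , []) , refl) , []
  zeckendorf-below zero (suc n) (s≤s ())
  zeckendorf-below (suc zero) zero _ = [] , (([] , []) , refl) , []
  zeckendorf-below (suc zero) (suc n) (s≤s ())
  zeckendorf-below (suc (suc k)) n n<f =
    by-cases (n <? fib (suc k)) (zeckendorf-below (suc k) n) (zeckendorf-below k (n ∸ fib (suc k)))
    where
    by-cases : Dec (n < fib (suc k)) → (n < fib (suc k) → ZeckendorfBelow (suc k) n) →
      (n ∸ fib (suc k) < fib k → ZeckendorfBelow k (n ∸ fib (suc k))) → ZeckendorfBelow (suc (suc k)) n
    by-cases (yes n<f′) below _ with below n<f′
    ... | I , isZ , I<k = I , isZ , All.map m<n⇒m<1+n I<k
    by-cases (no n≮f′) _ below =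
      zeckendorf-add-fib k n (≮⇒≥ n≮f′) (below (m<n+o⇒m∸n<o n (fib (suc k)) {{>-nonZero (1≤fib k)}} n<f))

  zeckendorf-exists : ∀ n → Σ (List ℕ) (IsZ n)
  zeckendorf-exists n with zeckendorf-below (suc n) n (<-≤-trans (n<1+n n) (n≤fib (suc n)))
  ... | I , isZ , _ = I , isZ

  split-largest : ∀ k I → TwoPartition I → All (_< suc (suc k)) I →
    All (_< suc k) I ⊎ Σ (List ℕ) λ I′ → I ≡ I′ ++ [ suc k ] × All (_< k) I′
  split-largest k [] _ _ = inj₁ []
  split-largest k (i ∷ I) tp (i< ∷ I<) with i <? suc k | split-largest k I (TwoPartition-tail tp) I<
  ... | yes i<k | inj₁ I<k = inj₁ (i<k ∷ I<k)
  split-largest k (i ∷ []) _ _ | yes _ | inj₂ ([] , () , _)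
  split-largest k (i ∷ []) _ _ | yes _ | inj₂ (_ ∷ _ , () , _)
  split-largest k (i ∷ j ∷ I) (_ , gap ∷ _) (_ ∷ j< ∷ _) | yes _ | inj₂ (I′ , eq , I′<k) =
    inj₂ (i ∷ I′ , cong (i ∷_) eq , ≤-pred (subst (_≤ suc k) (+-comm i 2) (≤-trans gap (≤-pred j<))) ∷ I′<k)
  split-largest k (i ∷ []) _ (i< ∷ _) | no i≮k | _ = inj₂ ([] , cong [_] (≤-antisym (≤-pred i<) (≮⇒≥ i≮k)) , [])
  split-largest k (i ∷ j ∷ I) (_ , gap ∷ _) (_ ∷ j< ∷ _) | no i≮k | _ =
    ⊥-elim (1+n≰n (≤-trans (n≤1+n _) (≤-trans (≤-trans (s≤s (s≤s (≮⇒≥ i≮k))) (subst (_≤ j) (+-comm i 2) gap)) (≤-pred j<))))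

  fsum<fib : ∀ k I → TwoPartition I → All (_< k) I → fsum I < fib k
  fsum<fib zero [] _ _ = s≤s z≤n
  fsum<fib zero (i ∷ I) _ (() ∷ _)
  fsum<fib (suc zero) [] _ _ = s≤s z≤n
  fsum<fib (suc zero) (i ∷ I) ((1≤i ∷ _) , _) (i<1 ∷ _) = ⊥-elim (<-irrefl refl (≤-trans (s≤s 1≤i) i<1))
  fsum<fib (suc (suc k)) I tp I< = by-cases (split-largest k I tp I<) (fsum<fib (suc k) I tp) (fsum<fib k)
    where
    by-cases : (All (_< suc k) I ⊎ Σ (List ℕ) λ I′ → I ≡ I′ ++ [ suc k ] × All (_< k) I′) →
      (All (_< suc k) I → fsum I < fib (suc k)) → (∀ I′ → TwoPartition I′ → All (_< k) I′ → fsum I′ < fib k) →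
      fsum I < fib (suc (suc k))
    by-cases (inj₁ I<k) below _ = <-≤-trans (below I<k) (m≤m+n _ _)
    by-cases (inj₂ (I′ , refl , I′<k)) _ below = begin-strict
      fsum (I′ ++ [ suc k ])      ≡⟨ fsum-++ I′ [ suc k ] ⟩
      fsum I′ + (fib (suc k) + 0) <⟨ +-monoˡ-< _ (below I′ (TwoPartition-++⁻ˡ tp) I′<k) ⟩
      fib k + (fib (suc k) + 0)   ≡⟨ cong (fib k +_) (+-identityʳ _) ⟩
      fib k + fib (suc k)         ≡⟨ +-comm (fib k) _ ⟩
      fib (suc (suc k)) ∎
      where open ≤-Reasoning

  zeckendorf-unique-below : ∀ k I J → TwoPartition I → TwoPartition J → All (_< k) I → All (_< k) J →
    fsum I ≡ fsum J → I ≡ J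
  zeckendorf-unique-below zero [] [] _ _ _ _ _ = refl
  zeckendorf-unique-below zero (i ∷ I) _ _ _ (() ∷ _) _ _
  zeckendorf-unique-below zero [] (j ∷ J) _ _ _ (() ∷ _) _
  zeckendorf-unique-below (suc zero) [] [] _ _ _ _ _ = refl
  zeckendorf-unique-below (suc zero) (i ∷ I) _ ((1≤i ∷ _) , _) _ (i<1 ∷ _) _ _ = ⊥-elim (<-irrefl refl (≤-trans (s≤s 1≤i) i<1))
  zeckendorf-unique-below (suc zero) [] (j ∷ J) _ ((1≤j ∷ _) , _) _ (j<1 ∷ _) _ = ⊥-elim (<-irrefl refl (≤-trans (s≤s 1≤j) j<1))
  zeckendorf-unique-below (suc (suc k)) I J tpI tpJ I< J< sum≡ =
    by-cases (split-largest k I tpI I<) (split-largest k J tpJ J<) (zeckendorf-unique-below (suc k) I J tpI tpJ) (zeckendorf-unique-below k)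
    where
    Split : List ℕ → Set
    Split X = All (_< suc k) X ⊎ Σ (List ℕ) λ X′ → X ≡ X′ ++ [ suc k ] × All (_< k) X′
    fib≤fsum-++ : ∀ X → fib (suc k) ≤ fsum (X ++ [ suc k ])
    fib≤fsum-++ X = subst (fib (suc k) ≤_) (sym (fsum-++ X [ suc k ])) (≤-trans (m≤n+m _ (fsum X)) (+-monoʳ-≤ (fsum X) (≤-reflexive (sym (+-identityʳ _)))))
    by-cases : Split I → Split J → (All (_< suc k) I → All (_< suc k) J → fsum I ≡ fsum J → I ≡ J) →
      (∀ I J → TwoPartition I → TwoPartition J → All (_< k) I → All (_< k) J → fsum I ≡ fsum J → I ≡ J) → I ≡ J
    by-cases (inj₁ I<k) (inj₁ J<k) unique _ = unique I<k J<k sum≡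
    by-cases (inj₂ (I′ , refl , I′<k)) (inj₂ (J′ , refl , J′<k)) _ unique =
      cong (_++ [ suc k ]) (unique I′ J′ (TwoPartition-++⁻ˡ tpI) (TwoPartition-++⁻ˡ tpJ) I′<k J′<k
        (+-cancelʳ-≡ _ _ _ (trans (sym (fsum-++ I′ [ suc k ])) (trans sum≡ (fsum-++ J′ [ suc k ])))))
    by-cases (inj₁ I<k) (inj₂ (J′ , refl , _)) _ _ =
      ⊥-elim (<-irrefl refl (<-≤-trans (fsum<fib (suc k) I tpI I<k) (subst (fib (suc k) ≤_) (sym sum≡) (fib≤fsum-++ J′))))
    by-cases (inj₂ (I′ , refl , _)) (inj₁ J<k) _ _ =
      ⊥-elim (<-irrefl refl (<-≤-trans (fsum<fib (suc k) J tpJ J<k) (subst (fib (suc k) ≤_) sum≡ (fib≤fsum-++ I′))))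

  zeckendorf-unique : ∀ {n I J} → IsZ n I → IsZ n J → I ≡ J
  zeckendorf-unique {n} {I} {J} (tpI , sumI) (tpJ , sumJ) =
    zeckendorf-unique-below (suc n) I J tpI tpJ (below I sumI) (below J sumJ) (trans sumI (sym sumJ))
    where
    below : ∀ K → fsum K ≡ n → All (_< suc n) K
    below K sumK = All.map (λ {i} p → s≤s (≤-trans (n≤fib i) (subst (fib i ≤_) sumK p))) (fib≤fsum K)

-- Positive c d stands for c + dτ > 0: since f (k + 1) / f k → τ, this holds
-- iff c f k + d f (k + 1) > 0 for all large k, and by the Fibonacci
-- recursion two consecutive positive values already suffice.
module GoldenPositivity where

  open import Data.Nat as ℕ using (ℕ; zero; suc; z≤n; s≤s)
  import Data.Nat.Properties as ℕ
  open import Data.Integer using (ℤ; +_; -_; _+_; _*_; _<_; +<+)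
  import Data.Integer.Properties as ℤ
  open import Data.Integer.Tactic.RingSolver using (solve-∀)
  open import Data.Product using (Σ; _,_)
  open import Relation.Binary.PropositionalEquality

  record PositiveFrom (k : ℕ) (c d : ℤ) : Set where
    constructor _,_
    field
      now  : + 0 < c * + fib k + d * + fib (suc k)
      next : + 0 < c * + fib (suc k) + d * + fib (suc (suc k))

  Positive : ℤ → ℤ → Set
  Positive c d = Σ ℕ λ k → PositiveFrom k c d

  PositiveFrom-suc : ∀ {k c d} → PositiveFrom k c d → PositiveFrom (suc k) c d
  PositiveFrom-suc {k} {c} {d} (now , next) = next , subst (+ 0 <_) (sym (recurrence c d (+ fib (suc k)) (+ fib k))) (ℤ.+-mono-< next now)
    where
    recurrence : ∀ c d x y → c * (x + y) + d * ((x + y) + x) ≡ (c * x + d * (x + y)) + (c * y + d * x)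
    recurrence = solve-∀

  PositiveFrom-+ : ∀ j {k c d} → PositiveFrom k c d → PositiveFrom (j ℕ.+ k) c d
  PositiveFrom-+ zero p = p
  PositiveFrom-+ (suc j) p = PositiveFrom-suc (PositiveFrom-+ j p)

  Positive-+ : ∀ {c d c′ d′} → Positive c d → Positive c′ d′ → Positive (c + c′) (d + d′)
  Positive-+ {c} {d} {c′} {d′} (k , p) (k′ , p′) = k′ ℕ.+ k , add (PositiveFrom-+ k′ p) (subst (λ j → PositiveFrom j c′ d′) (ℕ.+-comm k k′) (PositiveFrom-+ k p′))
    where
    distrib : ∀ c d c′ d′ x y → (c + c′) * x + (d + d′) * y ≡ (c * x + d * y) + (c′ * x + d′ * y)
    distrib = solve-∀
    add : ∀ {j} → PositiveFrom j c d → PositiveFrom j c′ d′ → PositiveFrom j (c + c′) (d + d′)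
    add (now , next) (now′ , next′) =
      subst (+ 0 <_) (sym (distrib c d c′ d′ _ _)) (ℤ.+-mono-< now now′) , subst (+ 0 <_) (sym (distrib c d c′ d′ _ _)) (ℤ.+-mono-< next next′)

  -- τ (c + dτ) = d + (c + d)τ
  Positive-÷τ : ∀ {c d} → Positive d (c + d) → Positive c d
  Positive-÷τ {c} {d} (k , (now , next)) = suc k ,
    (subst (+ 0 <_) (shift₁ c d (+ fib (suc k)) (+ fib k)) now , subst (+ 0 <_) (shift₂ c d (+ fib (suc k)) (+ fib k)) next)
    where
    shift₁ : ∀ c d x y → d * y + (c + d) * x ≡ c * x + d * (x + y)
    shift₁ = solve-∀
    shift₂ : ∀ c d x y → d * x + (c + d) * (x + y) ≡ c * (x + y) + d * ((x + y) + x)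
    shift₂ = solve-∀

  Positive-÷τ² : ∀ {c d} → Positive (c + d) (d + (c + d)) → Positive c d
  Positive-÷τ² {c} {d} p = Positive-÷τ {c} {d} (Positive-÷τ {d} {c + d} p)

  Positive-÷τ³ : ∀ {c d} → Positive (d + (c + d)) ((c + d) + (d + (c + d))) → Positive c d
  Positive-÷τ³ {c} {d} p = Positive-÷τ² {c} {d} (Positive-÷τ {c + d} {d + (c + d)} p)

  Positive-1 : Positive (+ 1) (+ 0)
  Positive-1 = 0 , (+<+ (s≤s z≤n) , +<+ (s≤s z≤n))

  Positive-τ : Positive (+ 0) (+ 1)
  Positive-τ = 0 , (+<+ (s≤s z≤n) , +<+ (s≤s z≤n))

  Positive-τ-1 : Positive (- + 1) (+ 1)
  Positive-τ-1 = 1 , (+<+ (s≤s z≤n) , +<+ (s≤s z≤n))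

module Parity where

  open import Data.Nat using (ℕ; zero; suc; _*_)
  open import Data.Nat.Tactic.RingSolver using (solve-∀)
  open import Data.Product using (Σ; _,_)
  open import Data.Sum using (_⊎_; inj₁; inj₂)
  open import Relation.Binary.PropositionalEquality

  double : ℕ → ℕ
  double zero = zero
  double (suc h) = suc (suc (double h))

  double≡2* : ∀ h → double h ≡ 2 * h
  double≡2* zero = refl
  double≡2* (suc h) = trans (cong (λ z → suc (suc z)) (double≡2* h)) (2+2*h h)
    where
    2+2*h : ∀ h → suc (suc (2 * h)) ≡ 2 * suc h
    2+2*h = solve-∀

  parity-view : ∀ k → Σ ℕ λ h → k ≡ double h ⊎ k ≡ suc (double h)
  parity-view zero = 0 , inj₁ refl
  parity-view (suc k) with parity-view k
  ... | h , inj₁ refl = h , inj₂ refl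
  ... | h , inj₂ refl = suc h , inj₁ refl

module ShiftedFsum where

  open Zeckendorf
  open import Data.Nat using (ℕ; suc; _+_)
  open import Data.Nat.Properties
  open import Data.Nat.Tactic.RingSolver using (solve-∀)
  open import Data.List using (List; []; _∷_; map)
  open import Relation.Binary.PropositionalEquality

  fsumFrom : ℕ → List ℕ → ℕ
  fsumFrom s [] = 0
  fsumFrom s (j ∷ J) = fib (s + j) + fsumFrom s J

  fsumFrom-0 : ∀ J → fsumFrom 0 J ≡ fsum J
  fsumFrom-0 [] = refl
  fsumFrom-0 (j ∷ J) = cong (fib j +_) (fsumFrom-0 J)

  fsumFrom-suc-suc : ∀ s J → fsumFrom (suc (suc s)) J ≡ fsumFrom (suc s) J + fsumFrom s J
  fsumFrom-suc-suc s [] = refl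
  fsumFrom-suc-suc s (j ∷ J) rewrite fsumFrom-suc-suc s J = interchange (fib (suc (s + j))) (fib (s + j)) (fsumFrom (suc s) J) (fsumFrom s J)
    where
    interchange : ∀ a b c d → (a + b) + (c + d) ≡ (a + c) + (b + d)
    interchange = solve-∀

  fsumFrom-map-+ : ∀ s c J → fsumFrom s (map (c +_) J) ≡ fsumFrom (s + c) J
  fsumFrom-map-+ s c [] = refl
  fsumFrom-map-+ s c (j ∷ J) rewrite fsumFrom-map-+ s c J | +-assoc s c j = refl

  fsumFrom-2 : ∀ J → fsumFrom 2 J ≡ fsumFrom 1 J + fsumFrom 0 J
  fsumFrom-2 = fsumFrom-suc-suc 0

  fsumFrom-3 : ∀ J → fsumFrom 3 J ≡ fsumFrom 1 J + fsumFrom 0 J + fsumFrom 1 J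
  fsumFrom-3 J rewrite fsumFrom-suc-suc 1 J | fsumFrom-2 J = refl

  fsumFrom-4 : ∀ J → fsumFrom 4 J ≡ (fsumFrom 1 J + fsumFrom 0 J + fsumFrom 1 J) + (fsumFrom 1 J + fsumFrom 0 J)
  fsumFrom-4 J rewrite fsumFrom-suc-suc 2 J | fsumFrom-3 J | fsumFrom-2 J = refl

  fsumFrom-1-map-2+ : ∀ J → fsumFrom 1 (map (2 +_) J) ≡ fsumFrom 1 J + fsumFrom 0 J + fsumFrom 1 J
  fsumFrom-1-map-2+ J = trans (fsumFrom-map-+ 1 2 J) (fsumFrom-3 J)

  fsumFrom-0-map-2+ : ∀ J → fsumFrom 0 (map (2 +_) J) ≡ fsumFrom 1 J + fsumFrom 0 J
  fsumFrom-0-map-2+ J = trans (fsumFrom-map-+ 0 2 J) (fsumFrom-2 J)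

  fsumFrom-1-map-3+ : ∀ J → fsumFrom 1 (map (3 +_) J) ≡ (fsumFrom 1 J + fsumFrom 0 J + fsumFrom 1 J) + (fsumFrom 1 J + fsumFrom 0 J)
  fsumFrom-1-map-3+ J = trans (fsumFrom-map-+ 1 3 J) (fsumFrom-4 J)

  fsumFrom-0-map-3+ : ∀ J → fsumFrom 0 (map (3 +_) J) ≡ fsumFrom 1 J + fsumFrom 0 J + fsumFrom 1 J
  fsumFrom-0-map-3+ J = trans (fsumFrom-map-+ 0 3 J) (fsumFrom-3 J)

module GoldenBrackets where

  open Zeckendorf
  open GoldenPositivity
  open ShiftedFsum
  open Parity
  open import Data.Nat as ℕ using (ℕ; zero; suc; z≤n; s≤s)
  import Data.Nat.Properties as ℕ
  open import Data.Integer using (+_; -_; _+_)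
  open import Data.Integer.Tactic.RingSolver using (solve-∀)
  open import Data.List using (List; []; _∷_; map)
  open import Data.List.Relation.Unary.All using (All; []; _∷_)
  open import Data.List.Relation.Unary.Linked as Linked using (Linked)
  open import Data.Product using (_×_; _,_)
  open import Relation.Binary.PropositionalEquality

  -- m τ < a + 1 < (m + 1) τ
  Bracketed : ℕ → ℕ → Set
  Bracketed a m = Positive (+ suc a) (- + m) × Positive (- + suc a) (+ suc m)

  -- a < m τ
  BelowMulτ : ℕ → ℕ → Set
  BelowMulτ a m = Positive (- + a) (+ m)

  bracketed-0 : Bracketed 0 0
  bracketed-0 = Positive-1 , Positive-τ-1

  bracketed-shift : ∀ {a m} → Bracketed a m → Bracketed (a ℕ.+ m ℕ.+ a) (a ℕ.+ m)
  bracketed-shift {a} {m} (lower , upper) =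
    Positive-÷τ² (subst₂ Positive (lower₁ (+ a) (+ m)) (lower₂ (+ a) (+ m)) (Positive-+ lower Positive-τ)) ,
    Positive-÷τ² (subst₂ Positive (upper₁ (+ a) (+ m)) (upper₂ (+ a) (+ m)) (Positive-+ upper Positive-1))
    where
    lower₁ : ∀ x y → (+ 1 + x) + + 0 ≡ (+ 1 + (x + y + x)) + (- (x + y))
    lower₁ = solve-∀
    lower₂ : ∀ x y → (- y) + + 1 ≡ (- (x + y)) + ((+ 1 + (x + y + x)) + (- (x + y)))
    lower₂ = solve-∀
    upper₁ : ∀ x y → (- (+ 1 + x)) + + 1 ≡ (- (+ 1 + (x + y + x))) + (+ 1 + (x + y))
    upper₁ = solve-∀
    upper₂ : ∀ x y → (+ 1 + y) + + 0 ≡ (+ 1 + (x + y)) + ((- (+ 1 + (x + y + x))) + (+ 1 + (x + y)))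
    upper₂ = solve-∀

  bracketed-cons-0 : ∀ {a m} → Bracketed a m → Bracketed (1 ℕ.+ (a ℕ.+ m ℕ.+ a)) (1 ℕ.+ (a ℕ.+ m))
  bracketed-cons-0 {a} {m} (lower , upper) =
    Positive-÷τ² (subst₂ Positive (lower₁ (+ a) (+ m)) (lower₂ (+ a) (+ m)) lower) ,
    Positive-÷τ² (subst₂ Positive (upper₁ (+ a) (+ m)) (upper₂ (+ a) (+ m)) (Positive-+ upper (Positive-+ Positive-1 Positive-τ)))
    where
    lower₁ : ∀ x y → + 1 + x ≡ (+ 2 + (x + y + x)) + (- (+ 1 + (x + y)))
    lower₁ = solve-∀
    lower₂ : ∀ x y → - y ≡ (- (+ 1 + (x + y))) + ((+ 2 + (x + y + x)) + (- (+ 1 + (x + y))))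
    lower₂ = solve-∀
    upper₁ : ∀ x y → (- (+ 1 + x)) + (+ 1 + + 0) ≡ (- (+ 2 + (x + y + x))) + (+ 2 + (x + y))
    upper₁ = solve-∀
    upper₂ : ∀ x y → (+ 1 + y) + (+ 0 + + 1) ≡ (+ 2 + (x + y)) + ((- (+ 2 + (x + y + x))) + (+ 2 + (x + y)))
    upper₂ = solve-∀

  bracketed-cons-1 : ∀ {a m} → Bracketed a m → Bracketed (2 ℕ.+ ((a ℕ.+ m ℕ.+ a) ℕ.+ (a ℕ.+ m))) (1 ℕ.+ (a ℕ.+ m ℕ.+ a))
  bracketed-cons-1 {a} {m} (lower , upper) =
    Positive-÷τ³ (subst₂ Positive (lower₁ (+ a) (+ m)) (lower₂ (+ a) (+ m)) (Positive-+ upper two)) ,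
    Positive-÷τ³ (subst₂ Positive (upper₁ (+ a) (+ m)) (upper₂ (+ a) (+ m)) lower)
    where
    two = Positive-+ (Positive-+ Positive-1 Positive-τ) (Positive-+ Positive-1 Positive-τ)
    lower₁ : ∀ x y → (- (+ 1 + x)) + ((+ 1 + + 0) + (+ 1 + + 0)) ≡ (- (+ 1 + (x + y + x))) + ((+ 3 + ((x + y + x) + (x + y))) + (- (+ 1 + (x + y + x))))
    lower₁ = solve-∀
    lower₂ : ∀ x y → (+ 1 + y) + ((+ 0 + + 1) + (+ 0 + + 1)) ≡ ((+ 3 + ((x + y + x) + (x + y))) + (- (+ 1 + (x + y + x)))) + ((- (+ 1 + (x + y + x))) + ((+ 3 + ((x + y + x) + (x + y))) + (- (+ 1 + (x + y + x)))))
    lower₂ = solve-∀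
    upper₁ : ∀ x y → + 1 + x ≡ (+ 2 + (x + y + x)) + ((- (+ 3 + ((x + y + x) + (x + y)))) + (+ 2 + (x + y + x)))
    upper₁ = solve-∀
    upper₂ : ∀ x y → - y ≡ ((- (+ 3 + ((x + y + x) + (x + y)))) + (+ 2 + (x + y + x))) + ((+ 2 + (x + y + x)) + ((- (+ 3 + ((x + y + x) + (x + y)))) + (+ 2 + (x + y + x))))
    upper₂ = solve-∀

  below-cons-0 : ∀ {a m} → Bracketed a m → BelowMulτ (1 ℕ.+ (a ℕ.+ m ℕ.+ a)) (1 ℕ.+ (a ℕ.+ m))
  below-cons-0 {a} {m} (_ , upper) =
    Positive-÷τ² (subst₂ Positive (below₁ (+ a) (+ m)) (below₂ (+ a) (+ m)) (Positive-+ upper Positive-1))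
    where
    below₁ : ∀ x y → (- (+ 1 + x)) + + 1 ≡ (- (+ 1 + (x + y + x))) + (+ 1 + (x + y))
    below₁ = solve-∀
    below₂ : ∀ x y → (+ 1 + y) + + 0 ≡ (+ 1 + (x + y)) + ((- (+ 1 + (x + y + x))) + (+ 1 + (x + y)))
    below₂ = solve-∀

  below-shift : ∀ {a m} → BelowMulτ a m → BelowMulτ (a ℕ.+ m ℕ.+ a) (a ℕ.+ m)
  below-shift {a} {m} below = Positive-÷τ² (subst₂ Positive (below₁ (+ a) (+ m)) (below₂ (+ a) (+ m)) below)
    where
    below₁ : ∀ x y → - x ≡ (- (x + y + x)) + (x + y)
    below₁ = solve-∀
    below₂ : ∀ x y → y ≡ (x + y) + ((- (x + y + x)) + (x + y))
    below₂ = solve-∀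

  BracketedFsum : List ℕ → Set
  BracketedFsum J = Bracketed (fsumFrom 1 J) (fsumFrom 0 J)

  BelowMulτFsum : List ℕ → Set
  BelowMulτFsum J = BelowMulτ (fsumFrom 1 J) (fsumFrom 0 J)

  BracketedFsum-map-2+ : ∀ J → BracketedFsum J → BracketedFsum (map (2 ℕ.+_) J)
  BracketedFsum-map-2+ J br = subst₂ Bracketed (sym (fsumFrom-1-map-2+ J)) (sym (fsumFrom-0-map-2+ J)) (bracketed-shift br)

  BracketedFsum-0∷ : ∀ J → BracketedFsum J → BracketedFsum (0 ∷ map (2 ℕ.+_) J)
  BracketedFsum-0∷ J br = subst₂ Bracketed (cong suc (sym (fsumFrom-1-map-2+ J))) (cong suc (sym (fsumFrom-0-map-2+ J))) (bracketed-cons-0 br)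

  BracketedFsum-1∷ : ∀ J → BracketedFsum J → BracketedFsum (1 ∷ map (3 ℕ.+_) J)
  BracketedFsum-1∷ J br = subst₂ Bracketed (cong (2 ℕ.+_) (sym (fsumFrom-1-map-3+ J))) (cong suc (sym (fsumFrom-0-map-3+ J))) (bracketed-cons-1 br)

  BelowMulτFsum-map-2+ : ∀ J → BelowMulτFsum J → BelowMulτFsum (map (2 ℕ.+_) J)
  BelowMulτFsum-map-2+ J below = subst₂ BelowMulτ (sym (fsumFrom-1-map-2+ J)) (sym (fsumFrom-0-map-2+ J)) (below-shift below)

  BelowMulτFsum-0∷ : ∀ J → BracketedFsum J → BelowMulτFsum (0 ∷ map (2 ℕ.+_) J)
  BelowMulτFsum-0∷ J br = subst₂ BelowMulτ (cong suc (sym (fsumFrom-1-map-2+ J))) (cong suc (sym (fsumFrom-0-map-2+ J))) (below-cons-0 br)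

  weight : List ℕ → ℕ
  weight [] = 0
  weight (j ∷ J) = suc j ℕ.+ weight J

  weight-map-∸ : ∀ c J → weight (map (ℕ._∸ c) J) ℕ.≤ weight J
  weight-map-∸ c [] = z≤n
  weight-map-∸ c (j ∷ J) = ℕ.+-mono-≤ (s≤s (ℕ.m∸n≤m j c)) (weight-map-∸ c J)

  bracketed-fsum-fuel : ∀ n J → weight J ℕ.≤ n → Linked Gap J → BracketedFsum J
  bracketed-fsum-fuel n [] _ _ = bracketed-0
  bracketed-fsum-fuel (suc n) (zero ∷ J) w≤n L =
    subst (λ X → BracketedFsum (0 ∷ X)) (map-+-∸ 2 J J≥2)
      (BracketedFsum-0∷ J₂ (bracketed-fsum-fuel n J₂ (ℕ.≤-trans (weight-map-∸ 2 J) (ℕ.≤-pred w≤n)) (Linked-gap-map-∸ 2 J≥2 (Linked.tail L))))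
    where
    J≥2 = Linked-gap-lower-bound (s≤s (s≤s z≤n)) L
    J₂ = map (ℕ._∸ 2) J
  bracketed-fsum-fuel (suc n) (suc zero ∷ J) w≤n L =
    subst (λ X → BracketedFsum (1 ∷ X)) (map-+-∸ 3 J J≥3)
      (BracketedFsum-1∷ J₃ (bracketed-fsum-fuel n J₃ (ℕ.≤-trans (weight-map-∸ 3 J) (ℕ.≤-trans (ℕ.n≤1+n _) (ℕ.≤-pred w≤n))) (Linked-gap-map-∸ 3 J≥3 (Linked.tail L))))
    where
    J≥3 = Linked-gap-lower-bound ℕ.≤-refl L
    J₃ = map (ℕ._∸ 3) J
  bracketed-fsum-fuel (suc n) J@(suc (suc j) ∷ J′) w≤n L =
    subst BracketedFsum (map-+-∸ 2 J J≥2)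
      (BracketedFsum-map-2+ J₂ (bracketed-fsum-fuel n J₂ (ℕ.≤-pred (ℕ.<-≤-trans weight< w≤n)) (Linked-gap-map-∸ 2 J≥2 L)))
    where
    J≥2 : All (2 ℕ.≤_) J
    J≥2 = s≤s (s≤s z≤n) ∷ Linked-gap-lower-bound (ℕ.≤-trans (s≤s (s≤s z≤n)) (ℕ.m≤n+m _ (suc (suc j)))) L
    J₂ = map (ℕ._∸ 2) J
    weight< : weight J₂ ℕ.< weight J
    weight< = ℕ.+-mono-<-≤ (s≤s (s≤s (ℕ.n≤1+n j))) (weight-map-∸ 2 J′)

  bracketed-fsum : ∀ J → Linked Gap J → BracketedFsum J
  bracketed-fsum J = bracketed-fsum-fuel (weight J) J ℕ.≤-refl

  below-fsum : ∀ h J → Linked Gap (double h ∷ J) → BelowMulτFsum (double h ∷ J)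
  below-fsum zero J L =
    subst (λ X → BelowMulτFsum (0 ∷ X)) (map-+-∸ 2 J J≥2) (BelowMulτFsum-0∷ J₂ (bracketed-fsum J₂ (Linked-gap-map-∸ 2 J≥2 (Linked.tail L))))
    where
    J≥2 = Linked-gap-lower-bound (s≤s (s≤s z≤n)) L
    J₂ = map (ℕ._∸ 2) J
  below-fsum (suc h) J L =
    subst BelowMulτFsum (map-+-∸ 2 I I≥2) (BelowMulτFsum-map-2+ I₂ (below-fsum h (map (ℕ._∸ 2) J) (Linked-gap-map-∸ 2 I≥2 L)))
    where
    I = double (suc h) ∷ J
    I≥2 : All (2 ℕ.≤_) I
    I≥2 = s≤s (s≤s z≤n) ∷ Linked-gap-lower-bound (ℕ.≤-trans (s≤s (s≤s z≤n)) (ℕ.m≤n+m _ (double (suc h)))) L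
    I₂ = map (ℕ._∸ 2) I

module GoldenFloor where

  open Zeckendorf using (Gap; 1≤fib)
  open GoldenPositivity
  open ShiftedFsum
  open GoldenBrackets
  open Parity
  open import Data.Nat using (ℕ; zero; suc; z≤n; s≤s; _+_; _*_; _∸_; _≤_; _<_; _≤?_; _<?_)
  open import Data.Nat.Properties
  open import Data.Nat.Tactic.RingSolver using (solve-∀)
  open import Data.Integer as ℤ using (+_; -_; +<+)
  import Data.Integer.Properties as ℤ
  open import Data.List using (_∷_)
  open import Data.List.Relation.Unary.Linked using (Linked)
  open import Data.Product using (Σ; _×_; _,_)
  open import Data.Sum using (inj₁; inj₂)
  open import Data.Empty using (⊥; ⊥-elim)
  open import Relation.Nullary using (¬_; yes; no)
  open import Relation.Binary.PropositionalEquality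
  open import Relation.Binary.Definitions using (tri<; tri≈; tri>)

  -- a < m τ  and  m τ < A, squared out using τ² = τ + 1
  LtMulτ : ℕ → ℕ → Set
  LtMulτ a m = a * a < a * m + m * m

  GtMulτ : ℕ → ℕ → Set
  GtMulτ A m = A * m + m * m < A * A

  combination-positive⇒< : ∀ a F m G → + 0 ℤ.< (- + a) ℤ.* + F ℤ.+ (+ m) ℤ.* + G → a * F < m * G
  combination-positive⇒< a F m G pos with a * F <? m * G
  ... | yes lt = lt
  ... | no ≮ = ⊥-elim (0≮-n (subst (+ 0 ℤ.<_) combination≡ pos))
    where
    combination≡ : (- + a) ℤ.* + F ℤ.+ (+ m) ℤ.* + G ≡ - + (a * F ∸ m * G)
    combination≡ = begin
      (- + a) ℤ.* + F ℤ.+ (+ m) ℤ.* + G ≡⟨ cong₂ ℤ._+_ (sym (ℤ.neg-distribˡ-* (+ a) (+ F))) (sym (ℤ.pos-* m G)) ⟩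
      - (+ a ℤ.* + F) ℤ.+ + (m * G)     ≡⟨ cong (λ z → - z ℤ.+ + (m * G)) (sym (ℤ.pos-* a F)) ⟩
      - + (a * F) ℤ.+ + (m * G)         ≡⟨ ℤ.-m+n≡n⊖m (a * F) (m * G) ⟩
      (m * G) ℤ.⊖ (a * F)               ≡⟨ ℤ.⊖-≤ (≮⇒≥ ≮) ⟩
      - + (a * F ∸ m * G) ∎
      where open ≡-Reasoning
    0≮-n : ∀ {x} → ¬ (+ 0 ℤ.< - + x)
    0≮-n {zero} (+<+ ())
    0≮-n {suc x} ()

  combination-positive⇒> : ∀ A F m G → + 0 ℤ.< (+ A) ℤ.* + F ℤ.+ (- + m) ℤ.* + G → m * G < A * F
  combination-positive⇒> A F m G pos = combination-positive⇒< m G A F (subst (+ 0 ℤ.<_) (ℤ.+-comm ((+ A) ℤ.* + F) _) pos)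

  cassini-even : ∀ h → fib (suc (double h)) * fib (suc (double h)) + 1 ≡ fib (suc (double h)) * fib (double h) + fib (double h) * fib (double h)
  cassini-odd : ∀ h → fib (suc (suc (double h))) * fib (suc (suc (double h))) ≡ fib (suc (suc (double h))) * fib (suc (double h)) + fib (suc (double h)) * fib (suc (double h)) + 1
  cassini-even zero = refl
  cassini-even (suc h) = step (fib (suc (suc (double h)))) (fib (suc (double h))) (cassini-odd h)
    where
    step : ∀ p q → p * p ≡ p * q + q * q + 1 → (p + q) * (p + q) + 1 ≡ (p + q) * p + p * p
    step p q e = begin
      (p + q) * (p + q) + 1               ≡⟨ expand p q ⟩
      p * p + q * p + (p * q + q * q + 1) ≡⟨ cong (λ z → p * p + q * p + z) (sym e) ⟩
      p * p + q * p + p * p               ≡⟨ collect p q ⟩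
      (p + q) * p + p * p ∎
      where
      open ≡-Reasoning
      expand : ∀ p q → (p + q) * (p + q) + 1 ≡ p * p + q * p + (p * q + q * q + 1)
      expand = solve-∀
      collect : ∀ p q → p * p + q * p + p * p ≡ (p + q) * p + p * p
      collect = solve-∀
  cassini-odd h = step (fib (suc (double h))) (fib (double h)) (cassini-even h)
    where
    step : ∀ p q → p * p + 1 ≡ p * q + q * q → (p + q) * (p + q) ≡ (p + q) * p + p * p + 1
    step p q e = begin
      (p + q) * (p + q)               ≡⟨ expand p q ⟩
      p * p + q * p + (p * q + q * q) ≡⟨ cong (λ z → p * p + q * p + z) (sym e) ⟩
      p * p + q * p + (p * p + 1)     ≡⟨ collect p q ⟩
      (p + q) * p + p * p + 1 ∎
      where
      open ≡-Reasoning
      expand : ∀ p q → (p + q) * (p + q) ≡ p * p + q * p + (p * q + q * q)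
      expand = solve-∀
      collect : ∀ p q → p * p + q * p + (p * p + 1) ≡ (p + q) * p + p * p + 1
      collect = solve-∀

  square-split : ∀ X M → M ≤ X → X * X ≡ X * M + X * (X ∸ M)
  square-split X M M≤X = trans (cong (X *_) (sym (m+[n∸m]≡n M≤X))) (*-distribˡ-+ X M (X ∸ M))

  LtMulτ-mono : ∀ {X Y} M → X < Y → LtMulτ Y M → LtMulτ X M
  LtMulτ-mono {X} {Y} M X<Y Y<Mτ with X ≤? M
  ... | yes X≤M = <-≤-trans (≤-<-trans (*-monoʳ-≤ X X≤M) (m<m+n (X * M) (*-mono-< 0<M 0<M))) ≤-refl
    where
    0<M : 0 < M
    0<M = n≢0⇒n>0 λ { refl → n≮0 (subst (Y * Y <_) (trans (+-identityʳ (Y * 0)) (*-zeroʳ Y)) Y<Mτ) }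
  ... | no X≰M = begin-strict
      X * X           ≡⟨ square-split X M (<⇒≤ M<X) ⟩
      X * M + X * (X ∸ M) <⟨ +-monoʳ-< (X * M) (<-trans (*-mono-< X<Y (∸-monoˡ-< X<Y (<⇒≤ M<X))) Y[Y∸M]<MM) ⟩
      X * M + M * M ∎
    where
    open ≤-Reasoning
    M<X = ≰⇒> X≰M
    Y[Y∸M]<MM : Y * (Y ∸ M) < M * M
    Y[Y∸M]<MM = +-cancelˡ-< (Y * M) _ (M * M) (subst (_< Y * M + M * M) (square-split Y M (<⇒≤ (<-trans M<X X<Y))) Y<Mτ)

  GtMulτ-mono : ∀ {X Y} M → Y < X → GtMulτ Y M → GtMulτ X M
  GtMulτ-mono {X} {Y} M Y<X Mτ<Y = begin-strict
      X * M + M * M       <⟨ +-monoʳ-< (X * M) (<-trans MM<Y[Y∸M] (*-mono-< Y<X (∸-monoˡ-< Y<X (<⇒≤ M<Y)))) ⟩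
      X * M + X * (X ∸ M) ≡⟨ sym (square-split X M (<⇒≤ (<-trans M<Y Y<X))) ⟩
      X * X ∎
    where
    open ≤-Reasoning
    M<Y : M < Y
    M<Y with M <? Y
    ... | yes p = p
    ... | no p = ⊥-elim (<-irrefl refl (<-≤-trans Mτ<Y (≤-trans (*-monoʳ-≤ Y (≮⇒≥ p)) (m≤m+n (Y * M) (M * M)))))
    MM<Y[Y∸M] : M * M < Y * (Y ∸ M)
    MM<Y[Y∸M] = +-cancelˡ-< (Y * M) (M * M) _ (subst (Y * M + M * M <_) (square-split Y M (<⇒≤ M<Y)) Mτ<Y)

  private
    scale-square : ∀ a q → (a * q) * (a * q) ≡ (q * q) * (a * a)
    scale-square = solve-∀
    scale-form : ∀ a m q → (a * q) * (m * q) + (m * q) * (m * q) ≡ (q * q) * (a * m + m * m)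
    scale-form = solve-∀
    scale-square′ : ∀ m p → (m * p) * (m * p) ≡ (m * m) * (p * p)
    scale-square′ = solve-∀
    scale-form′ : ∀ m p q → (m * p) * (m * q) + (m * q) * (m * q) ≡ (m * m) * (p * q + q * q)
    scale-form′ = solve-∀

  -- p / q < τ is a convergent from below, and a / m < p / q
  LtMulτ-via-convergent : ∀ a m p q → 0 < q → a * q < m * p → p * p + 1 ≡ p * q + q * q → LtMulτ a m
  LtMulτ-via-convergent a zero p q _ aq<0 _ = ⊥-elim (n≮0 aq<0)
  LtMulτ-via-convergent a m@(suc _) p q 0<q@(s≤s _) aq<mp cassini =
    *-cancelˡ-< (q * q) (a * a) (a * m + m * m)
      (subst₂ _<_ (scale-square a q) (scale-form a m q) (LtMulτ-mono (m * q) aq<mp mp<mqτ))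
    where
    p<qτ : LtMulτ p q
    p<qτ = subst (p * p <_) cassini (subst (_≤ p * p + 1) (+-comm (p * p) 1) ≤-refl)
    mp<mqτ : LtMulτ (m * p) (m * q)
    mp<mqτ = subst₂ _<_ (sym (scale-square′ m p)) (sym (scale-form′ m p q)) (*-monoʳ-< (m * m) p<qτ)

  GtMulτ-via-convergent : ∀ A m p q → 0 < q → m * p < A * q → p * p ≡ p * q + q * q + 1 → GtMulτ A m
  GtMulτ-via-convergent zero m p q _ mp<0 _ = ⊥-elim (n≮0 mp<0)
  GtMulτ-via-convergent A@(suc A′) zero p q _ _ _ = subst (_< A * A) (sym (trans (+-identityʳ (A * 0)) (*-zeroʳ A))) (s≤s z≤n)
  GtMulτ-via-convergent A m@(suc _) p q 0<q@(s≤s _) mp<Aq cassini =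
    *-cancelˡ-< (q * q) (A * m + m * m) (A * A)
      (subst₂ _<_ (scale-form A m q) (scale-square A q) (GtMulτ-mono (m * q) mp<Aq mqτ<mp))
    where
    qτ<p : GtMulτ p q
    qτ<p = subst (p * q + q * q <_) (sym cassini) (subst (_≤ p * q + q * q + 1) (+-comm (p * q + q * q) 1) ≤-refl)
    mqτ<mp : GtMulτ (m * p) (m * q)
    mqτ<mp = subst₂ _<_ (sym (scale-form′ m p q)) (sym (scale-square′ m p)) (*-monoʳ-< (m * m) qτ<p)

  BelowMulτ⇒LtMulτ : ∀ a m → BelowMulτ a m → LtMulτ a m
  BelowMulτ⇒LtMulτ a m (k , (now , next)) with parity-view k
  ... | h , inj₁ refl = LtMulτ-via-convergent a m _ _ (1≤fib (double h)) (combination-positive⇒< a _ m _ now) (cassini-even h)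
  ... | h , inj₂ refl = LtMulτ-via-convergent a m _ _ (1≤fib (double (suc h))) (combination-positive⇒< a _ m _ next) (cassini-even (suc h))

  Bracketed⇒GtMulτ : ∀ a m → Bracketed a m → GtMulτ (suc a) m
  Bracketed⇒GtMulτ a m ((k , (now , next)) , _) with parity-view k
  ... | h , inj₁ refl = GtMulτ-via-convergent (suc a) m _ _ (1≤fib (suc (double h)))
    (combination-positive⇒> (suc a) (fib (suc (double h))) m (fib (suc (suc (double h)))) next) (cassini-odd h)
  ... | h , inj₂ refl = GtMulτ-via-convergent (suc a) m _ _ (1≤fib (suc (double h)))
    (combination-positive⇒> (suc a) (fib (suc (double h))) m (fib (suc (suc (double h)))) now) (cassini-odd h)

  private
    quadruple-square : ∀ a → 4 * (a * a) ≡ (2 * a) * (2 * a)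
    quadruple-square = solve-∀
    quadruple-form : ∀ a m → 4 * (a * m + m * m) ≡ 2 * (2 * a) * m + 4 * (m * m)
    quadruple-form = solve-∀
    square-+ : ∀ t m → (t + m) * (t + m) ≡ t * t + (2 * t * m + m * m)
    square-+ = solve-∀
    form-+ : ∀ t m → 2 * (t + m) * m + 4 * (m * m) ≡ 5 * (m * m) + (2 * t * m + m * m)
    form-+ = solve-∀

  -- with t = 2a − m:  a < mτ ⇔ t < m√5
  LtMulτ⇒<√5 : ∀ t m a → 2 * a ≡ t + m → LtMulτ a m → t * t < 5 * (m * m)
  LtMulτ⇒<√5 t m a 2a≡t+m a<mτ = +-cancelʳ-< (2 * t * m + m * m) (t * t) (5 * (m * m)) (subst₂ _<_ (square-+ t m) (form-+ t m) 4×)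
    where
    4× : (t + m) * (t + m) < 2 * (t + m) * m + 4 * (m * m)
    4× = subst (λ s → s * s < 2 * s * m + 4 * (m * m)) 2a≡t+m (subst₂ _<_ (quadruple-square a) (quadruple-form a m) (*-monoʳ-< 4 a<mτ))

  GtMulτ⇒>√5 : ∀ t m A → 2 * A ≡ t + m → GtMulτ A m → 5 * (m * m) < t * t
  GtMulτ⇒>√5 t m A 2A≡t+m mτ<A = +-cancelʳ-< (2 * t * m + m * m) (5 * (m * m)) (t * t) (subst₂ _<_ (form-+ t m) (square-+ t m) 4×)
    where
    4× : 2 * (t + m) * m + 4 * (m * m) < (t + m) * (t + m)
    4× = subst (λ s → 2 * s * m + 4 * (m * m) < s * s) 2A≡t+m (subst₂ _<_ (quadruple-form A m) (quadruple-square A) (*-monoʳ-< 4 mτ<A))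

  isFloorMulTau : ∀ a m → LtMulτ a m → GtMulτ (suc a) m → IsFloorMulTau m a
  isFloorMulTau a m a<mτ mτ<A = a≤mτ , (m<2A , GtMulτ⇒>√5 (2 * suc a ∸ m) m (suc a) (sym (m∸n+n≡m (<⇒≤ m<2A))) mτ<A)
    where
    a≤mτ : LeHalfSqrt5 a m m
    a≤mτ with 2 * a ≤? m
    ... | yes 2a≤m = inj₁ 2a≤m
    ... | no 2a≰m = inj₂ (<⇒≤ (LtMulτ⇒<√5 (2 * a ∸ m) m a (sym (m∸n+n≡m (<⇒≤ (≰⇒> 2a≰m)))) a<mτ))
    m<2A : m < 2 * suc a
    m<2A with m <? 2 * suc a
    ... | yes p = p
    ... | no p = ⊥-elim (<-irrefl refl (<-≤-trans mτ<A (≤-trans (*-monoʳ-≤ (suc a) (≤-trans (m≤m+n (suc a) (suc a + 0)) (≮⇒≥ p))) (m≤m+n (suc a * m) (m * m)))))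

  LtHalfSqrt5-LeHalfSqrt5-< : ∀ {m a a′} → a < a′ → LtHalfSqrt5 m m (suc a) → LeHalfSqrt5 a′ m m → ⊥
  LtHalfSqrt5-LeHalfSqrt5-< a<a′ (m<2a+2 , _) (inj₁ 2a′≤m) = <-irrefl refl (<-≤-trans m<2a+2 (≤-trans (*-monoʳ-≤ 2 a<a′) 2a′≤m))
  LtHalfSqrt5-LeHalfSqrt5-< {m} a<a′ (_ , √5m<t) (inj₂ t′≤√5m) = <-irrefl refl (<-≤-trans √5m<t (≤-trans (*-mono-≤ t≤t′ t≤t′) t′≤√5m))
    where
    t≤t′ = ∸-monoˡ-≤ m (*-monoʳ-≤ 2 a<a′)

  IsFloorMulTau-unique : ∀ m {a a′} → IsFloorMulTau m a → IsFloorMulTau m a′ → a ≡ a′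
  IsFloorMulTau-unique m {a} {a′} (a≤ , <a+1) (a′≤ , <a′+1) with <-cmp a a′
  ... | tri< a<a′ _ _ = ⊥-elim (LtHalfSqrt5-LeHalfSqrt5-< a<a′ <a+1 a′≤)
  ... | tri≈ _ a≡a′ _ = a≡a′
  ... | tri> _ _ a′<a = ⊥-elim (LtHalfSqrt5-LeHalfSqrt5-< a′<a <a′+1 a≤)

  private
    2[a+m]≡2m+2a : ∀ a m → 2 * (a + m) ≡ 2 * m + 2 * a
    2[a+m]≡2m+2a = solve-∀
    3m≡2m+m : ∀ m → 3 * m ≡ 2 * m + m
    3m≡2m+m = solve-∀

  2[a+m]∸3m≡2a∸m : ∀ a m → 2 * (a + m) ∸ 3 * m ≡ 2 * a ∸ m
  2[a+m]∸3m≡2a∸m a m rewrite 2[a+m]≡2m+2a a m | 3m≡2m+m m = [m+n]∸[m+o]≡n∸o (2 * m) (2 * a) m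

  2[a+m]≤3m⇒2a≤m : ∀ a m → 2 * (a + m) ≤ 3 * m → 2 * a ≤ m
  2[a+m]≤3m⇒2a≤m a m le rewrite 2[a+m]≡2m+2a a m | 3m≡2m+m m = +-cancelˡ-≤ (2 * m) (2 * a) m le

  2a≤m⇒2[a+m]≤3m : ∀ a m → 2 * a ≤ m → 2 * (a + m) ≤ 3 * m
  2a≤m⇒2[a+m]≤3m a m le rewrite 2[a+m]≡2m+2a a m | 3m≡2m+m m = +-monoʳ-≤ (2 * m) le

  3m<2[a+m]⇒m<2a : ∀ a m → 3 * m < 2 * (a + m) → m < 2 * a
  3m<2[a+m]⇒m<2a a m lt rewrite 2[a+m]≡2m+2a a m | 3m≡2m+m m = +-cancelˡ-< (2 * m) m (2 * a) lt

  m<2a⇒3m<2[a+m] : ∀ a m → m < 2 * a → 3 * m < 2 * (a + m)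
  m<2a⇒3m<2[a+m] a m lt rewrite 2[a+m]≡2m+2a a m | 3m≡2m+m m = +-monoʳ-< (2 * m) lt

  -- m τ² = m τ + m
  IsFloorMulTau⇒IsFloorMulTau² : ∀ m a → IsFloorMulTau m a → IsFloorMulTau² m (a + m)
  IsFloorMulTau⇒IsFloorMulTau² m a (a≤ , (m<2A , √5m<t)) =
    shift-≤ a≤ , (m<2a⇒3m<2[a+m] (suc a) m m<2A , subst (λ z → 5 * (m * m) < z * z) (sym (2[a+m]∸3m≡2a∸m (suc a) m)) √5m<t)
    where
    shift-≤ : LeHalfSqrt5 a m m → LeHalfSqrt5 (a + m) (3 * m) m
    shift-≤ (inj₁ p) = inj₁ (2a≤m⇒2[a+m]≤3m a m p)
    shift-≤ (inj₂ p) = inj₂ (subst (λ z → z * z ≤ 5 * (m * m)) (sym (2[a+m]∸3m≡2a∸m a m)) p)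

  IsFloorMulTau²⇒IsFloorMulTau : ∀ m b → IsFloorMulTau² m b → Σ ℕ λ a → b ≡ a + m × IsFloorMulTau m a
  IsFloorMulTau²⇒IsFloorMulTau m b (b≤ , (3m<2B , √5m<t)) =
    a , b≡a+m , shift-≤ b≤ , (3m<2[a+m]⇒m<2a (suc a) m 3m<2A , subst (λ z → 5 * (m * m) < z * z) (2[a+m]∸3m≡2a∸m (suc a) m) √5m<t′)
    where
    m≤b : m ≤ b
    m≤b with m ≤? b
    ... | yes p = p
    ... | no p = ⊥-elim (<-irrefl refl (<-≤-trans 3m<2B (≤-trans (*-monoʳ-≤ 2 (≰⇒> p)) (*-monoˡ-≤ m {2} {3} (s≤s (s≤s z≤n))))))
    a = b ∸ m
    b≡a+m : b ≡ a + m
    b≡a+m = sym (m∸n+n≡m m≤b)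
    shift-≤ : LeHalfSqrt5 b (3 * m) m → LeHalfSqrt5 a m m
    shift-≤ (inj₁ p) = inj₁ (2[a+m]≤3m⇒2a≤m a m (subst (λ z → 2 * z ≤ 3 * m) b≡a+m p))
    shift-≤ (inj₂ p) = inj₂ (subst (λ z → z * z ≤ 5 * (m * m)) (2[a+m]∸3m≡2a∸m a m) (subst (λ z → (2 * z ∸ 3 * m) * (2 * z ∸ 3 * m) ≤ 5 * (m * m)) b≡a+m p))
    3m<2A : 3 * m < 2 * (suc a + m)
    3m<2A = subst (λ z → 3 * m < 2 * suc z) b≡a+m 3m<2B
    √5m<t′ : 5 * (m * m) < (2 * (suc a + m) ∸ 3 * m) * (2 * (suc a + m) ∸ 3 * m)
    √5m<t′ = subst (λ z → 5 * (m * m) < (2 * suc z ∸ 3 * m) * (2 * suc z ∸ 3 * m)) b≡a+m √5m<t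

  floorMulτ-fsum : ∀ h J → Linked Gap (double h ∷ J) → IsFloorMulTau (fsumFrom 0 (double h ∷ J)) (fsumFrom 1 (double h ∷ J))
  floorMulτ-fsum h J L =
    isFloorMulTau _ _ (BelowMulτ⇒LtMulτ _ _ (below-fsum h J L)) (Bracketed⇒GtMulτ _ _ (bracketed-fsum (double h ∷ J) L))

module BlockLayout where

  open Zeckendorf using (Gap)
  open Parity
  open import Data.Nat using (ℕ; zero; suc; z≤n; s≤s; _+_; _*_; _∸_; _≤_; _%_; _/_; _≡ᵇ_)
  open import Data.Nat.Properties
  import Data.Nat.DivMod as DivMod
  open import Data.Nat.ListAction using (sum)
  open import Data.Nat.Tactic.RingSolver using (solve-∀)
  open import Data.Bool using (true; false)
  open import Data.List using (List; []; _∷_; [_]; map; _++_; length; reverse; take; applyUpTo)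
  import Data.List.Properties as List
  open import Data.List.Relation.Unary.All as All using (All; []; _∷_)
  import Data.List.Relation.Unary.All.Properties as All
  open import Data.List.Relation.Unary.Linked using (Linked; []; [-]; _∷_)
  open import Data.Product using (Σ; _×_; _,_; proj₁; proj₂)
  open import Data.Sum using (_⊎_; inj₁; inj₂)
  open import Relation.Binary.PropositionalEquality hiding ([_])

  parity : ℕ → ℕ
  parity zero = 0
  parity (suc zero) = 1
  parity (suc (suc x)) = parity x

  %2≡parity : ∀ x → x % 2 ≡ parity x
  %2≡parity zero = refl
  %2≡parity (suc zero) = refl
  %2≡parity (suc (suc x)) = trans (trans (cong (_% 2) (+-comm 2 x)) (DivMod.[m+n]%n≡m%n x 2)) (%2≡parity x)

  parity-odd : ∀ h → parity (suc (double h)) ≡ 1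
  parity-odd zero = refl
  parity-odd (suc h) = parity-odd h

  parity-+-2* : ∀ x k → parity (x + 2 * k) ≡ parity x
  parity-+-2* x zero = cong parity (+-identityʳ x)
  parity-+-2* x (suc k) = trans (cong parity (x+2[1+k] x k)) (parity-+-2* x k)
    where
    x+2[1+k] : ∀ x k → x + 2 * suc k ≡ suc (suc (x + 2 * k))
    x+2[1+k] = solve-∀

  sameParity≡ : ∀ x y → sameParity x y ≡ (parity x ≡ᵇ parity y)
  sameParity≡ x y = cong₂ _≡ᵇ_ (%2≡parity x) (%2≡parity y)

  sameParity-suc : ∀ x y → sameParity (suc x) (suc y) ≡ sameParity x y
  sameParity-suc x y = trans (sameParity≡ (suc x) (suc y)) (trans (parity-suc x y) (sym (sameParity≡ x y)))
    where
    parity-suc : ∀ x y → (parity (suc x) ≡ᵇ parity (suc y)) ≡ (parity x ≡ᵇ parity y)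
    parity-suc zero zero = refl
    parity-suc zero (suc zero) = refl
    parity-suc zero (suc (suc y)) = parity-suc zero y
    parity-suc (suc zero) zero = refl
    parity-suc (suc zero) (suc zero) = refl
    parity-suc (suc zero) (suc (suc y)) = parity-suc (suc zero) y
    parity-suc (suc (suc x)) y = parity-suc x y

  sameParity-+ : ∀ c x y → sameParity (c + x) (c + y) ≡ sameParity x y
  sameParity-+ zero x y = refl
  sameParity-+ (suc c) x y = trans (sameParity-suc (c + x) (c + y)) (sameParity-+ c x y)

  sameParity-true : ∀ {p x} → parity p ≡ parity x → sameParity p x ≡ true
  sameParity-true {p} {x} e = trans (sameParity≡ p x) (trans (cong (_≡ᵇ parity x) e) (≡ᵇ-refl (parity x)))
    where
    ≡ᵇ-refl : ∀ n → (n ≡ᵇ n) ≡ true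
    ≡ᵇ-refl zero = refl
    ≡ᵇ-refl (suc n) = ≡ᵇ-refl n

  sameParity-false : ∀ {p x} → parity p ≡ parity (suc x) → sameParity p x ≡ false
  sameParity-false {p} {x} e = trans (sameParity≡ p x) (trans (cong (_≡ᵇ parity x) e) (parity-suc-≢ x))
    where
    parity-suc-≢ : ∀ x → (parity (suc x) ≡ᵇ parity x) ≡ false
    parity-suc-≢ zero = refl
    parity-suc-≢ (suc zero) = refl
    parity-suc-≢ (suc (suc x)) = parity-suc-≢ x

  sameParity-cong : ∀ {p p′} i → parity p ≡ parity p′ → sameParity p i ≡ sameParity p′ i
  sameParity-cong {p} {p′} i e = trans (sameParity≡ p i) (trans (cong (_≡ᵇ parity i) e) (sym (sameParity≡ p′ i)))

  glueHead : List ℕ → List (List ℕ) → List (List ℕ)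
  glueHead L [] = [ L ]
  glueHead L (B ∷ R) = (L ++ B) ∷ R

  runsAcc-glueHead : ∀ p acc xs → runsAcc p acc xs ≡ glueHead (reverse acc) (runsAcc p [] xs)
  runsAcc-glueHead p acc [] = cong [_] (sym (List.++-identityʳ (reverse acc)))
  runsAcc-glueHead p acc ((i , a) ∷ xs) with sameParity p i
  ... | true = begin
      runsAcc p (a ∷ acc) xs                                 ≡⟨ runsAcc-glueHead p (a ∷ acc) xs ⟩
      glueHead (reverse (a ∷ acc)) (runsAcc p [] xs)         ≡⟨ cong (λ z → glueHead z (runsAcc p [] xs)) (List.unfold-reverse a acc) ⟩
      glueHead (reverse acc ++ [ a ]) (runsAcc p [] xs)      ≡⟨ sym (glueHead-++ (reverse acc) [ a ] (runsAcc p [] xs)) ⟩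
      glueHead (reverse acc) (glueHead [ a ] (runsAcc p [] xs)) ≡⟨ cong (glueHead (reverse acc)) (sym (runsAcc-glueHead p [ a ] xs)) ⟩
      glueHead (reverse acc) (runsAcc p [ a ] xs) ∎
    where
    open ≡-Reasoning
    glueHead-++ : ∀ L M R → glueHead L (glueHead M R) ≡ glueHead (L ++ M) R
    glueHead-++ L M [] = refl
    glueHead-++ L M (B ∷ R) = cong (_∷ R) (sym (List.++-assoc L M B))
  ... | false = cong (_∷ runsAcc i [ a ] xs) (sym (List.++-identityʳ (reverse acc)))

  runsAcc-++ : ∀ p acc ys zs → All (λ x → sameParity p (proj₁ x) ≡ true) ys →
    runsAcc p acc (ys ++ zs) ≡ runsAcc p (reverse (map proj₂ ys) ++ acc) zs
  runsAcc-++ p acc [] zs [] = refl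
  runsAcc-++ p acc ((i , a) ∷ ys) zs (e ∷ es) rewrite e =
    trans (runsAcc-++ p (a ∷ acc) ys zs es) (cong (λ z → runsAcc p z zs) reverse≡)
    where
    reverse≡ : reverse (map proj₂ ys) ++ a ∷ acc ≡ reverse (a ∷ map proj₂ ys) ++ acc
    reverse≡ = trans (sym (List.++-assoc (reverse (map proj₂ ys)) [ a ] acc)) (cong (_++ acc) (sym (List.unfold-reverse a (map proj₂ ys))))

  shiftIndex : ℕ → ℕ × ℕ → ℕ × ℕ
  shiftIndex c (i , a) = c + i , a

  runsAcc-shift : ∀ c p acc xs → runsAcc (c + p) acc (map (shiftIndex c) xs) ≡ runsAcc p acc xs
  runsAcc-shift c p acc [] = refl
  runsAcc-shift c p acc ((i , a) ∷ xs) rewrite sameParity-+ c p i with sameParity p i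
  ... | true = runsAcc-shift c p (a ∷ acc) xs
  ... | false = cong (reverse acc ∷_) (runsAcc-shift c i [ a ] xs)

  runsAcc-parity : ∀ p p′ acc xs → parity p ≡ parity p′ → runsAcc p acc xs ≡ runsAcc p′ acc xs
  runsAcc-parity p p′ acc [] e = refl
  runsAcc-parity p p′ acc ((i , a) ∷ xs) e rewrite sameParity-cong {p} {p′} i e with sameParity p′ i
  ... | true = runsAcc-parity p p′ (a ∷ acc) xs e
  ... | false = refl

  -- The 2-partition laid out by blocks started just after position s: each entry β
  -- advances by 2(β − 1), each new block by one more, so runs change parity exactly
  -- at block boundaries (the inverse of 𝒱).
  blockLayout : ℕ → List ℕ → List (ℕ × ℕ)
  blockLayout s [] = []
  blockLayout s (β ∷ B) = (suc (s + 2 * (β ∸ 1)) , β) ∷ blockLayout (s + 2 * (β ∸ 1)) B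

  layout : ℕ → List (List ℕ) → List (ℕ × ℕ)
  layout s [] = []
  layout s (B ∷ Bs) = blockLayout s B ++ layout (suc (s + 2 * d B)) Bs

  NonEmpty : List ℕ → Set
  NonEmpty B = Σ ℕ λ β → Σ (List ℕ) λ B′ → B ≡ β ∷ B′

  Block : List ℕ → Set
  Block B = NonEmpty B × All (1 ≤_) B

  Block₂ : List ℕ → Set
  Block₂ B = NonEmpty B × All (2 ≤_) B

  All-2≤⇒All-1≤ : ∀ {B} → All (2 ≤_) B → All (1 ≤_) B
  All-2≤⇒All-1≤ = All.map (≤-trans (s≤s z≤n))

  Block₂⇒Block : ∀ {B} → Block₂ B → Block B
  Block₂⇒Block (ne , B≥2) = ne , All-2≤⇒All-1≤ B≥2

  d-∷ : ∀ β X → 1 ≤ β → All (1 ≤_) X → d (β ∷ X) ≡ (β ∸ 1) + d X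
  d-∷ (suc β) X _ X≥1 = +-∸-assoc β (length≤sum X X≥1)
    where
    length≤sum : ∀ X → All (1 ≤_) X → length X ≤ sum X
    length≤sum [] [] = z≤n
    length≤sum (x ∷ X) (p ∷ ps) = +-mono-≤ p (length≤sum X ps)

  +2*d-∷ : ∀ s β X → 1 ≤ β → All (1 ≤_) X → s + 2 * d (β ∷ X) ≡ (s + 2 * (β ∸ 1)) + 2 * d X
  +2*d-∷ s β X β≥1 X≥1 rewrite d-∷ β X β≥1 X≥1 = regroup s (β ∸ 1) (d X)
    where
    regroup : ∀ s a b → s + 2 * (a + b) ≡ (s + 2 * a) + 2 * b
    regroup = solve-∀

  map-proj₂-blockLayout : ∀ s B → map proj₂ (blockLayout s B) ≡ B
  map-proj₂-blockLayout s [] = refl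
  map-proj₂-blockLayout s (β ∷ B) = cong (β ∷_) (map-proj₂-blockLayout (s + 2 * (β ∸ 1)) B)

  blockLayout-sameParity : ∀ p s B → parity p ≡ parity (suc s) → All (λ x → sameParity p (proj₁ x) ≡ true) (blockLayout s B)
  blockLayout-sameParity p s [] e = []
  blockLayout-sameParity p s (β ∷ B) e =
    sameParity-true {p} {suc (s + 2 * (β ∸ 1))} e′ ∷ blockLayout-sameParity p (s + 2 * (β ∸ 1)) B e′
    where
    e′ = trans e (sym (parity-+-2* (suc s) (β ∸ 1)))

  reverse-reverse-blockLayout : ∀ s B acc → reverse (reverse (map proj₂ (blockLayout s B)) ++ acc) ≡ reverse acc ++ B
  reverse-reverse-blockLayout s B acc = begin
    reverse (reverse (map proj₂ (blockLayout s B)) ++ acc)       ≡⟨ List.reverse-++ (reverse (map proj₂ (blockLayout s B))) acc ⟩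
    reverse acc ++ reverse (reverse (map proj₂ (blockLayout s B))) ≡⟨ cong (reverse acc ++_) (List.reverse-involutive _) ⟩
    reverse acc ++ map proj₂ (blockLayout s B)                   ≡⟨ cong (reverse acc ++_) (map-proj₂-blockLayout s B) ⟩
    reverse acc ++ B ∎
    where open ≡-Reasoning

  runsAcc-layout : ∀ s B Bs p acc → parity p ≡ parity (suc s) → All (1 ≤_) B → All Block Bs →
    runsAcc p acc (blockLayout s B ++ layout (suc (s + 2 * d B)) Bs) ≡ (reverse acc ++ B) ∷ Bs
  runsAcc-layout s B [] p acc e B≥1 [] =
    trans (runsAcc-++ p acc (blockLayout s B) [] (blockLayout-sameParity p s B e)) (cong [_] (reverse-reverse-blockLayout s B acc))
  runsAcc-layout s B ((β ∷ B′) ∷ Bs) p acc e B≥1 (((_ , _ , refl) , β≥1 ∷ B′≥1) ∷ blocks) =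
    trans (runsAcc-++ p acc (blockLayout s B) _ (blockLayout-sameParity p s B e))
      (trans next-run (cong (_∷ (β ∷ B′) ∷ Bs) (reverse-reverse-blockLayout s B acc)))
    where
    s′ = suc (s + 2 * d B)
    s″ = s′ + 2 * (β ∸ 1)
    i = suc s″
    parity-flips : parity p ≡ parity (suc i)
    parity-flips = trans e (trans (sym (parity-+-2* (suc s) (d B + (β ∸ 1) + 1))) (cong parity (regroup s (d B) (β ∸ 1))))
      where
      regroup : ∀ s a b → suc s + 2 * (a + b + 1) ≡ suc (suc (suc (s + 2 * a) + 2 * b))
      regroup = solve-∀
    next-run : runsAcc p (reverse (map proj₂ (blockLayout s B)) ++ acc) ((i , β) ∷ (blockLayout s″ B′ ++ layout (suc (s′ + 2 * d (β ∷ B′))) Bs))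
           ≡ reverse (reverse (map proj₂ (blockLayout s B)) ++ acc) ∷ (β ∷ B′) ∷ Bs
    next-run rewrite sameParity-false {p} {i} parity-flips | +2*d-∷ s′ β B′ β≥1 B′≥1 =
      cong (reverse (reverse (map proj₂ (blockLayout s B)) ++ acc) ∷_) (runsAcc-layout s″ B′ Bs i [ β ] refl B′≥1 blocks)

  [2+m]/2≡1+m/2 : ∀ m → suc (suc m) / 2 ≡ suc (m / 2)
  [2+m]/2≡1+m/2 m = DivMod.m/n≡1+[m∸n]/n {suc (suc m)} {2} (s≤s (s≤s z≤n))

  2*k/2≡k : ∀ k → (2 * k) / 2 ≡ k
  2*k/2≡k k = trans (cong (_/ 2) (*-comm 2 k)) (DivMod.m*n/n≡m k 2)

  [1+2*k]/2≡k : ∀ k → suc (2 * k) / 2 ≡ k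
  [1+2*k]/2≡k zero = refl
  [1+2*k]/2≡k (suc k) = trans (cong (λ z → suc z / 2) (2[1+k] k)) (trans ([2+m]/2≡1+m/2 (suc (2 * k))) (cong suc ([1+2*k]/2≡k k)))
    where
    2[1+k] : ∀ k → 2 * suc k ≡ suc (suc (2 * k))
    2[1+k] = solve-∀

  -- The index preceding the layout from s: s + 1 within a block, s at the start of a
  -- block other than the first (where the parity changes and the block is nonempty).
  LayoutStart : ℕ → ℕ → List ℕ → Set
  LayoutStart prev s B = prev ≡ suc s ⊎ (prev ≡ s × NonEmpty B)

  LayoutStart⇒≤ : ∀ {prev s B} → LayoutStart prev s B → prev ≤ suc s
  LayoutStart⇒≤ (inj₁ e) = ≤-reflexive e
  LayoutStart⇒≤ (inj₂ (e , _)) = ≤-trans (≤-reflexive e) (n≤1+n _)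

  assoc-entry : ∀ prev s β → 1 ≤ β → prev ≡ suc s ⊎ prev ≡ s → (suc (s + 2 * (β ∸ 1)) ∸ prev) / 2 + 1 ≡ β
  assoc-entry prev s β β≥1 (inj₁ refl) =
    trans (cong (λ z → z / 2 + 1) (m+n∸m≡n s (2 * (β ∸ 1)))) (trans (cong (_+ 1) (2*k/2≡k (β ∸ 1))) (m∸n+n≡m β≥1))
  assoc-entry prev s β β≥1 (inj₂ refl) =
    trans (cong (λ z → z / 2 + 1) [1+s+x]∸s) (trans (cong (_+ 1) ([1+2*k]/2≡k (β ∸ 1))) (m∸n+n≡m β≥1))
    where
    [1+s+x]∸s : suc (s + 2 * (β ∸ 1)) ∸ s ≡ suc (2 * (β ∸ 1))
    [1+s+x]∸s = trans (cong (_∸ s) (sym (+-suc s _))) (m+n∸m≡n s (suc (2 * (β ∸ 1))))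

  assocVec-layout : ∀ s B Bs prev → LayoutStart prev s B → All (1 ≤_) B → All Block Bs →
    assocVecFrom prev (map proj₁ (blockLayout s B ++ layout (suc (s + 2 * d B)) Bs)) ≡ map proj₂ (blockLayout s B ++ layout (suc (s + 2 * d B)) Bs)
  assocVec-layout s (β ∷ B) Bs prev start (β≥1 ∷ B≥1) blocks rewrite +2*d-∷ s β B β≥1 B≥1 =
    cong₂ _∷_ (assoc-entry prev s β β≥1 (Data.Sum.map₂ proj₁ start))
      (assocVec-layout (s + 2 * (β ∸ 1)) B Bs (suc (s + 2 * (β ∸ 1))) (inj₁ refl) B≥1 blocks)
    where import Data.Sum
  assocVec-layout s [] [] prev _ _ _ = refl
  assocVec-layout s [] (B₂ ∷ Bs) prev (inj₁ refl) _ ((ne , B₂≥1) ∷ blocks) =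
    assocVec-layout (suc (s + 0)) B₂ Bs prev (inj₂ (cong suc (sym (+-identityʳ s)) , ne)) B₂≥1 blocks
  assocVec-layout s [] (B₂ ∷ Bs) prev (inj₂ (_ , _ , _ , ())) _ _

  Linked-layout : ∀ s B Bs prev → LayoutStart prev s B → All (2 ≤_) B → All Block₂ Bs →
    Linked Gap (prev ∷ map proj₁ (blockLayout s B ++ layout (suc (s + 2 * d B)) Bs))
  Linked-layout s (β ∷ B) Bs prev start (β≥2 ∷ B≥2) blocks rewrite +2*d-∷ s β B (≤-trans (s≤s z≤n) β≥2) (All-2≤⇒All-1≤ B≥2) =
    gap ∷ Linked-layout (s + 2 * (β ∸ 1)) B Bs (suc (s + 2 * (β ∸ 1))) (inj₁ refl) B≥2 blocks
    where
    2≤2[β∸1] : 2 ≤ 2 * (β ∸ 1)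
    2≤2[β∸1] = *-monoʳ-≤ 2 (∸-monoˡ-≤ 1 β≥2)
    gap : prev + 2 ≤ suc (s + 2 * (β ∸ 1))
    gap = ≤-trans (+-monoˡ-≤ 2 (LayoutStart⇒≤ start))
            (subst (_≤ suc (s + 2 * (β ∸ 1))) (+-comm 2 (suc s)) (s≤s (subst (suc (suc s) ≤_) (+-comm (2 * (β ∸ 1)) s) (+-monoˡ-≤ s 2≤2[β∸1]))))
  Linked-layout s [] [] prev _ _ _ = [-]
  Linked-layout s [] (B₂ ∷ Bs) prev (inj₁ refl) _ ((ne , B₂≥2) ∷ blocks) =
    Linked-layout (suc (s + 0)) B₂ Bs prev (inj₂ (cong suc (sym (+-identityʳ s)) , ne)) B₂≥2 blocks
  Linked-layout s [] (B₂ ∷ Bs) prev (inj₂ (_ , _ , _ , ())) _ _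

  applyUpTo-cong : ∀ {f g : ℕ → ℕ} n → (∀ k → f k ≡ g k) → applyUpTo f n ≡ applyUpTo g n
  applyUpTo-cong zero _ = refl
  applyUpTo-cong (suc n) f≗g = cong₂ _∷_ (f≗g 0) (applyUpTo-cong n (λ k → f≗g (suc k)))

  applyUpTo-blockLayout : ∀ s B → All (1 ≤_) B →
    applyUpTo (λ k → s + (2 * d (take (suc k) B) + 1)) (length B) ≡ map proj₁ (blockLayout s B)
  applyUpTo-blockLayout s [] _ = refl
  applyUpTo-blockLayout s (β ∷ B) (β≥1 ∷ B≥1) =
    cong₂ _∷_ head≡ (trans (applyUpTo-cong (length B) tail≡) (applyUpTo-blockLayout (s + 2 * (β ∸ 1)) B B≥1))
    where
    head≡ : s + (2 * d (β ∷ []) + 1) ≡ suc (s + 2 * (β ∸ 1))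
    head≡ rewrite +-identityʳ β = regroup s (β ∸ 1)
      where
      regroup : ∀ s x → s + (2 * x + 1) ≡ suc (s + 2 * x)
      regroup = solve-∀
    tail≡ : ∀ k → s + (2 * d (β ∷ take (suc k) B) + 1) ≡ (s + 2 * (β ∸ 1)) + (2 * d (take (suc k) B) + 1)
    tail≡ k rewrite d-∷ β (take (suc k) B) β≥1 (All.take⁺ (suc k) B≥1) = regroup s (β ∸ 1) (d (take (suc k) B))
      where
      regroup : ∀ s a b → s + (2 * (a + b) + 1) ≡ (s + 2 * a) + (2 * b + 1)
      regroup = solve-∀

  εB-blockLayout : ∀ s B → All (1 ≤_) B → map (s +_) (εB B) ≡ map proj₁ (blockLayout s B)
  εB-blockLayout s B B≥1 =
    trans (cong (map (s +_)) (List.map-applyUpTo (λ k → k) (λ k → 2 * d (take (suc k) B) + 1) (length B)))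
      (trans (List.map-applyUpTo (λ k → 2 * d (take (suc k) B) + 1) (s +_) (length B)) (applyUpTo-blockLayout s B B≥1))

  εFrom-layout : ∀ s Bs → All Block Bs → εFrom s Bs ≡ map proj₁ (layout s Bs)
  εFrom-layout s [] [] = refl
  εFrom-layout s (B ∷ Bs) ((_ , B≥1) ∷ blocks) =
    trans (cong₂ _++_ (εB-blockLayout s B B≥1) (trans (cong (λ z → εFrom z Bs) (+-comm (s + 2 * d B) 1)) (εFrom-layout (suc (s + 2 * d B)) Bs blocks)))
      (sym (List.map-++ proj₁ (blockLayout s B) (layout (suc (s + 2 * d B)) Bs)))

  m+n≤o⇒n≤o∸m : ∀ m n o → m + n ≤ o → n ≤ o ∸ m
  m+n≤o⇒n≤o∸m m n o le = subst (_≤ o ∸ m) (m+n∸m≡n m n) (∸-monoˡ-≤ m le)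

  2≤double⇒1≤ : ∀ {h} → 2 ≤ double h → 1 ≤ h
  2≤double⇒1≤ {suc h} _ = s≤s z≤n

  2≤1+double⇒1≤ : ∀ {h} → 2 ≤ suc (double h) → 1 ≤ h
  2≤1+double⇒1≤ {zero} (s≤s ())
  2≤1+double⇒1≤ {suc h} _ = s≤s z≤n

  LayoutTail : ℕ → List ℕ → Set
  LayoutTail s L = Σ (List ℕ) λ B → Σ (List (List ℕ)) λ Bs →
    All (2 ≤_) B × All Block₂ Bs × map proj₁ (blockLayout s B ++ layout (suc (s + 2 * d B)) Bs) ≡ L

  layoutTail-of-Linked : ∀ s L → Linked Gap (suc s ∷ L) → LayoutTail s L
  layoutTail-of-Linked s [] _ = [] , [] , [] , [] , refl
  layoutTail-of-Linked s (y ∷ L) (gap ∷ linked) with parity-view (y ∸ suc s)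
  ... | h , inj₁ e = same-block (layoutTail-of-Linked (s + 2 * h) L (subst (λ z → Linked Gap (z ∷ L)) y≡ linked))
    where
    y≡ : y ≡ suc (s + 2 * h)
    y≡ = trans (sym (m+[n∸m]≡n (≤-trans (m≤m+n (suc s) 2) gap))) (cong (λ z → suc (s + z)) (trans e (double≡2* h)))
    h≥1 : 1 ≤ h
    h≥1 = 2≤double⇒1≤ (subst (2 ≤_) e (m+n≤o⇒n≤o∸m (suc s) 2 y gap))
    same-block : LayoutTail (s + 2 * h) L → LayoutTail s (y ∷ L)
    same-block (B , Bs , B≥2 , blocks , eq) = suc h ∷ B , Bs , s≤s h≥1 ∷ B≥2 , blocks ,
      cong₂ _∷_ (sym y≡) (trans (cong (λ z → map proj₁ (blockLayout (s + 2 * h) B ++ layout (suc z) Bs)) (+2*d-∷ s (suc h) B (s≤s z≤n) (All-2≤⇒All-1≤ B≥2))) eq)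
  ... | h , inj₂ e = new-block (layoutTail-of-Linked (suc (s + 0) + 2 * h) L (subst (λ z → Linked Gap (z ∷ L)) y≡ linked))
    where
    y≡ : y ≡ suc (suc (s + 0) + 2 * h)
    y≡ = trans (sym (m+[n∸m]≡n (≤-trans (m≤m+n (suc s) 2) gap))) (trans (cong (λ z → suc s + z) (trans e (cong suc (double≡2* h)))) (regroup s h))
      where
      regroup : ∀ s h → suc s + suc (2 * h) ≡ suc (suc (s + 0) + 2 * h)
      regroup = solve-∀
    h≥1 : 1 ≤ h
    h≥1 = 2≤1+double⇒1≤ (subst (2 ≤_) e (m+n≤o⇒n≤o∸m (suc s) 2 y gap))
    new-block : LayoutTail (suc (s + 0) + 2 * h) L → LayoutTail s (y ∷ L)
    new-block (B₂ , Bs , B₂≥2 , blocks , eq) = [] , (suc h ∷ B₂) ∷ Bs , [] , ((suc h , B₂ , refl) , s≤s h≥1 ∷ B₂≥2) ∷ blocks ,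
      cong₂ _∷_ (sym y≡) (trans (cong (λ z → map proj₁ (blockLayout (suc (s + 0) + 2 * h) B₂ ++ layout (suc z) Bs)) (+2*d-∷ (suc (s + 0)) (suc h) B₂ (s≤s z≤n) (All-2≤⇒All-1≤ B₂≥2))) eq)

module CanonicalForm where

  open Zeckendorf using (Gap; Linked-gap-All)
  open Parity
  open BlockLayout
  open import Data.Nat using (ℕ; suc; z≤n; s≤s; _*_; _∸_; _≤_)
  open import Data.Nat.Properties using (≤-trans)
  open import Data.List using (List; []; _∷_; [_]; map; zip)
  open import Data.List.Relation.Unary.All as All using (All; []; _∷_)
  open import Data.List.Relation.Unary.Linked using (Linked)
  open import Data.Product using (Σ; _×_; _,_; proj₁; proj₂)
  open import Data.Sum using (inj₁)
  open import Relation.Binary.PropositionalEquality hiding ([_])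

  Canonical : List (List ℕ) → Set
  Canonical Bs = Σ ℕ λ β → Σ (List ℕ) λ B → Σ (List (List ℕ)) λ Bs′ →
    Bs ≡ (β ∷ B) ∷ Bs′ × 1 ≤ β × All (2 ≤_) B × All Block₂ Bs′

  Canonical⇒All-Block : ∀ {Bs} → Canonical Bs → All Block Bs
  Canonical⇒All-Block (β , B , Bs′ , refl , β≥1 , B≥2 , blocks) = ((β , B , refl) , β≥1 ∷ All-2≤⇒All-1≤ B≥2) ∷ All.map Block₂⇒Block blocks

  ε≡layout : ∀ {Bs} → Canonical Bs → ε Bs ≡ map proj₁ (layout 0 Bs)
  ε≡layout {Bs} c = εFrom-layout 0 Bs (Canonical⇒All-Block c)

  zip-map-proj : ∀ (xs : List (ℕ × ℕ)) → zip (map proj₁ xs) (map proj₂ xs) ≡ xs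
  zip-map-proj [] = refl
  zip-map-proj ((a , b) ∷ xs) = cong ((a , b) ∷_) (zip-map-proj xs)

  𝒱-ε : ∀ {Bs} → Canonical Bs → 𝒱 (ε Bs) ≡ Bs
  𝒱-ε {Bs} c@(β , B , Bs′ , refl , β≥1 , B≥2 , blocks) = begin
    𝒱 (ε Bs)                                                   ≡⟨ cong 𝒱 (ε≡layout c) ⟩
    runs (zip (map proj₁ (layout 0 Bs)) (assocVec (map proj₁ (layout 0 Bs)))) ≡⟨ cong (λ z → runs (zip (map proj₁ (layout 0 Bs)) z)) assoc≡ ⟩
    runs (zip (map proj₁ (layout 0 Bs)) (map proj₂ (layout 0 Bs))) ≡⟨ cong runs (zip-map-proj (layout 0 Bs)) ⟩
    runs (layout 0 Bs)                                         ≡⟨ runs≡ ⟩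
    Bs ∎
    where
    open ≡-Reasoning
    blocks′ = All.map Block₂⇒Block blocks
    assoc≡ : assocVec (map proj₁ (layout 0 Bs)) ≡ map proj₂ (layout 0 Bs)
    assoc≡ = assocVec-layout 0 (β ∷ B) Bs′ 1 (inj₁ refl) (β≥1 ∷ All-2≤⇒All-1≤ B≥2) blocks′
    runs≡ : runs (layout 0 Bs) ≡ Bs
    runs≡ rewrite +2*d-∷ 0 β B β≥1 (All-2≤⇒All-1≤ B≥2) =
      runsAcc-layout (2 * (β ∸ 1)) B Bs′ (suc (2 * (β ∸ 1))) [ β ] refl (All-2≤⇒All-1≤ B≥2) blocks′

  TwoPartition-ε : ∀ {Bs} → Canonical Bs → TwoPartition (ε Bs)
  TwoPartition-ε {Bs} c@(β , B , Bs′ , refl , β≥1 , B≥2 , blocks) = subst TwoPartition (sym (ε≡layout c)) twoPartition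
    where
    twoPartition : TwoPartition (map proj₁ (layout 0 Bs))
    twoPartition rewrite +2*d-∷ 0 β B β≥1 (All-2≤⇒All-1≤ B≥2) =
      let linked = Linked-layout (2 * (β ∸ 1)) B Bs′ (suc (2 * (β ∸ 1))) (inj₁ refl) B≥2 blocks
      in (s≤s z≤n ∷ All.map (≤-trans (s≤s z≤n)) (Linked-gap-All linked)) , linked

  odd-decomposition : ∀ h L → Linked Gap (suc (double h) ∷ L) →
    Σ (List ℕ) λ B → Σ (List (List ℕ)) λ Bs′ → All (2 ≤_) B × All Block₂ Bs′ ×
      𝒱 (suc (double h) ∷ L) ≡ (suc h ∷ B) ∷ Bs′ × ε ((suc h ∷ B) ∷ Bs′) ≡ suc (double h) ∷ L
  odd-decomposition h L linked with layoutTail-of-Linked (2 * h) L (subst (λ z → Linked Gap (suc z ∷ L)) (double≡2* h) linked)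
  ... | B , Bs′ , B≥2 , blocks , eq = B , Bs′ , B≥2 , blocks , trans (cong 𝒱 (sym ε≡)) (𝒱-ε c) , ε≡
    where
    c : Canonical ((suc h ∷ B) ∷ Bs′)
    c = suc h , B , Bs′ , refl , s≤s z≤n , B≥2 , blocks
    layout≡ : map proj₁ (layout 0 ((suc h ∷ B) ∷ Bs′)) ≡ suc (double h) ∷ L
    layout≡ rewrite +2*d-∷ 0 (suc h) B (s≤s z≤n) (All-2≤⇒All-1≤ B≥2) = cong₂ _∷_ (cong suc (sym (double≡2* h))) eq
    ε≡ : ε ((suc h ∷ B) ∷ Bs′) ≡ suc (double h) ∷ L
    ε≡ = trans (ε≡layout c) layout≡

module Continuant where

  open import Data.Nat as ℕ using (ℕ; suc; z≤n; s≤s; _+_; _*_; _∸_; _≤_; _<_)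
  open import Data.Nat.Properties
  open import Data.Nat.Tactic.RingSolver using (solve-∀)
  import Data.Integer as ℤ
  import Data.Integer.Properties as ℤ
  import Data.Integer.Tactic.RingSolver as ℤ
  open import Data.List using (List; []; _∷_; [_]; _++_; reverse)
  import Data.List.Properties as List
  open import Data.List.Relation.Unary.All using (All; []; _∷_)
  open import Data.Product using (_×_; _,_)
  open import Data.Empty using (⊥; ⊥-elim)
  open import Relation.Binary.PropositionalEquality hiding ([_])
  open import Relation.Binary.Definitions using (tri<; tri≈; tri>)

  Drev-++ : ∀ L b a → Drev (L ++ b ∷ a ∷ []) ≡ (ℤ.+ a) ℤ.* Drev (L ++ b ∷ []) ℤ.- Drev L
  Drev-++ [] b a = expand (ℤ.+ a) (ℤ.+ b)
    where
    expand : ∀ x y → y ℤ.* x ℤ.- ℤ.+ 1 ≡ x ℤ.* y ℤ.- ℤ.+ 1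
    expand = ℤ.solve-∀
  Drev-++ (x ∷ []) b a = expand (ℤ.+ a) (ℤ.+ b) (ℤ.+ x)
    where
    expand : ∀ a b x → x ℤ.* (b ℤ.* a ℤ.- ℤ.+ 1) ℤ.- a ≡ a ℤ.* (x ℤ.* b ℤ.- ℤ.+ 1) ℤ.- x
    expand = ℤ.solve-∀
  Drev-++ (x ∷ y ∷ L) b a rewrite Drev-++ (y ∷ L) b a | Drev-++ L b a =
    expand (ℤ.+ a) (ℤ.+ x) (Drev (y ∷ L ++ b ∷ [])) (Drev (y ∷ L)) (Drev (L ++ b ∷ [])) (Drev L)
    where
    expand : ∀ a x P Q R S → x ℤ.* (a ℤ.* P ℤ.- Q) ℤ.- (a ℤ.* R ℤ.- S) ≡ a ℤ.* (x ℤ.* P ℤ.- R) ℤ.- (x ℤ.* Q ℤ.- S)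
    expand = ℤ.solve-∀

  D-∷-∷ : ∀ a b r → D (a ∷ b ∷ r) ≡ (ℤ.+ a) ℤ.* D (b ∷ r) ℤ.- D r
  D-∷-∷ a b r = begin
    Drev (reverse (a ∷ b ∷ r))                                        ≡⟨ cong Drev reverse-∷-∷ ⟩
    Drev (reverse r ++ b ∷ a ∷ [])                                    ≡⟨ Drev-++ (reverse r) b a ⟩
    ℤ.+ a ℤ.* Drev (reverse r ++ [ b ]) ℤ.- Drev (reverse r)          ≡⟨ cong (λ z → ℤ.+ a ℤ.* Drev z ℤ.- Drev (reverse r)) (sym (List.unfold-reverse b r)) ⟩
    ℤ.+ a ℤ.* D (b ∷ r) ℤ.- D r ∎
    where
    open ≡-Reasoning
    reverse-∷-∷ : reverse (a ∷ b ∷ r) ≡ reverse r ++ b ∷ a ∷ []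
    reverse-∷-∷ = trans (List.unfold-reverse a (b ∷ r)) (trans (cong (_++ [ a ]) (List.unfold-reverse b r)) (List.++-assoc (reverse r) [ b ] [ a ]))

  continuant : List ℕ → ℕ
  continuant [] = 1
  continuant (a ∷ []) = a
  continuant (a ∷ b ∷ r) = a * continuant (b ∷ r) ∸ continuant r

  2X∸Y>X : ∀ X Y → Y < X → X < 2 * X ∸ Y
  2X∸Y>X X Y Y<X = +-cancelʳ-< Y X (2 * X ∸ Y) (subst (X + Y <_) (sym (m∸n+n≡m Y≤2X)) (subst (X + Y <_) (X+X≡2X X) (+-monoʳ-< X Y<X)))
    where
    Y≤2X : Y ≤ 2 * X
    Y≤2X = ≤-trans (<⇒≤ Y<X) (m≤m+n X (X + 0))
    X+X≡2X : ∀ X → X + X ≡ 2 * X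
    X+X≡2X = solve-∀

  continuant-<-∷ : ∀ b r → 2 ≤ b → All (2 ≤_) r → continuant r < continuant (b ∷ r)
  continuant-<-∷ b [] b≥2 [] = b≥2
  continuant-<-∷ b (c ∷ r) b≥2 (c≥2 ∷ r≥2) =
    <-≤-trans (2X∸Y>X (continuant (c ∷ r)) (continuant r) (continuant-<-∷ c r c≥2 r≥2)) (∸-monoˡ-≤ (continuant r) (*-monoˡ-≤ (continuant (c ∷ r)) b≥2))

  continuant-positive : ∀ r → All (2 ≤_) r → 1 ≤ continuant r
  continuant-positive [] _ = s≤s z≤n
  continuant-positive (b ∷ r) (b≥2 ∷ r≥2) = ≤-trans (continuant-positive r r≥2) (<⇒≤ (continuant-<-∷ b r b≥2 r≥2))

  continuant-≤-* : ∀ a b r → 1 ≤ a → All (2 ≤_) (b ∷ r) → continuant r ≤ a * continuant (b ∷ r)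
  continuant-≤-* a b r a≥1 (b≥2 ∷ r≥2) =
    ≤-trans (<⇒≤ (continuant-<-∷ b r b≥2 r≥2)) (subst (_≤ a * continuant (b ∷ r)) (*-identityˡ _) (*-monoˡ-≤ (continuant (b ∷ r)) a≥1))

  +m-+n≡+[m∸n] : ∀ m n → n ≤ m → ℤ.+ m ℤ.- ℤ.+ n ≡ ℤ.+ (m ∸ n)
  +m-+n≡+[m∸n] m n n≤m = trans (ℤ.[+m]-[+n]≡m⊖n m n) (ℤ.⊖-≥ n≤m)

  D≡continuant : ∀ a T → 1 ≤ a → All (2 ≤_) T → D (a ∷ T) ≡ ℤ.+ continuant (a ∷ T)
  D≡continuant a [] _ _ = refl
  D≡continuant a (b ∷ r) a≥1 (b≥2 ∷ r≥2) =
    trans (D-∷-∷ a b r) (trans (cong₂ (λ X Y → ℤ.+ a ℤ.* X ℤ.- Y) (D≡continuant b r (≤-trans (s≤s z≤n) b≥2) r≥2) (D≡continuant₂ r r≥2))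
      (trans (cong (ℤ._- ℤ.+ continuant r) (sym (ℤ.pos-* a _))) (+m-+n≡+[m∸n] _ _ (continuant-≤-* a b r a≥1 (b≥2 ∷ r≥2)))))
    where
    D≡continuant₂ : ∀ T → All (2 ≤_) T → D T ≡ ℤ.+ continuant T
    D≡continuant₂ [] _ = refl
    D≡continuant₂ (c ∷ T) (c≥2 ∷ T≥2) = D≡continuant c T (≤-trans (s≤s z≤n) c≥2) T≥2

  continuant-∷-positive : ∀ a T → 1 ≤ a → All (2 ≤_) T → 1 ≤ continuant (a ∷ T)
  continuant-∷-positive a [] a≥1 _ = a≥1
  continuant-∷-positive a (b ∷ r) a≥1 (b≥2 ∷ r≥2) =
    ≤-trans (m<n⇒0<n∸m (continuant-<-∷ b r b≥2 r≥2)) (∸-monoˡ-≤ (continuant r) (subst (_≤ a * continuant (b ∷ r)) (*-identityˡ _) (*-monoˡ-≤ (continuant (b ∷ r)) a≥1)))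

  continuant-suc : ∀ a C → 1 ≤ a → All (2 ≤_) C → continuant (suc a ∷ C) ≡ continuant (a ∷ C) + continuant C
  continuant-suc a [] _ _ = +-comm 1 a
  continuant-suc a (c ∷ r) a≥1 C≥2 = trans (+-∸-assoc (continuant (c ∷ r)) (continuant-≤-* a c r a≥1 C≥2)) (+-comm (continuant (c ∷ r)) _)

  remainder : List ℕ → ℕ
  remainder [] = 0
  remainder (_ ∷ r) = continuant r

  continuant-division : ∀ β T → 1 ≤ β → All (2 ≤_) T → continuant (β ∷ T) + remainder T ≡ β * continuant T
  continuant-division β [] _ _ = trans (+-identityʳ β) (sym (*-identityʳ β))
  continuant-division β (b ∷ r) β≥1 T≥2 = m∸n+n≡m (continuant-≤-* β b r β≥1 T≥2)

  remainder<continuant : ∀ T → All (2 ≤_) T → remainder T < continuant T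
  remainder<continuant [] _ = s≤s z≤n
  remainder<continuant (b ∷ r) (b≥2 ∷ r≥2) = continuant-<-∷ b r b≥2 r≥2

  -- β = ⌈q / p⌉ = ⌈q′ / p′⌉ = β′, and then r / p = β − q / p = r′ / p′
  equal-ratio-division : ∀ β β′ p p′ q q′ r r′ → q + r ≡ β * p → q′ + r′ ≡ β′ * p′ → r < p → r′ < p′ →
    p * q′ ≡ p′ * q → β ≡ β′ × p′ * r ≡ p * r′
  equal-ratio-division β β′ p p′ q q′ r r′ div div′ r<p r′<p′ cross = β≡β′ , p′r≡pr′
    where
    reassoc : ∀ p p′ β → p * (β * p′) ≡ (p * p′) * β
    reassoc = solve-∀
    reassoc′ : ∀ p p′ β → p′ * (β * p) ≡ (p * p′) * β
    reassoc′ = solve-∀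
    *-suc′ : ∀ P β → P * suc β ≡ P * β + P
    *-suc′ = solve-∀
    scaled′ : (p * p′) * β′ ≡ p′ * q + p * r′
    scaled′ = trans (sym (reassoc p p′ β′)) (trans (cong (p *_) (sym div′)) (trans (*-distribˡ-+ p q′ r′) (cong (_+ p * r′) cross)))
    scaled : (p * p′) * β ≡ p′ * q + p′ * r
    scaled = trans (sym (reassoc′ p p′ β)) (trans (cong (p′ *_) (sym div)) (*-distribˡ-+ p′ q r))
    pr′<pp′ : p * r′ < p * p′
    pr′<pp′ = *-monoʳ-< p {{ℕ.>-nonZero (≤-<-trans z≤n r<p)}} r′<p′
    p′r<pp′ : p′ * r < p * p′
    p′r<pp′ = subst (p′ * r <_) (*-comm p′ p) (*-monoʳ-< p′ {{ℕ.>-nonZero (≤-<-trans z≤n r′<p′)}} r<p)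
    no-< : ∀ b b′ P Q R₁ R₂ → P * b′ ≡ Q + R₁ → P * b ≡ Q + R₂ → R₁ < P → b < b′ → ⊥
    no-< b b′ P Q R₁ R₂ e₁ e₂ R₁<P b<b′ = <-irrefl refl (<-≤-trans R₁<P (+-cancelˡ-≤ Q P R₁ (subst (Q + P ≤_) e₁ Q+P≤Pb′)))
      where
      Q+P≤Pb′ : Q + P ≤ P * b′
      Q+P≤Pb′ = ≤-trans (≤-trans (+-monoˡ-≤ P (≤-trans (m≤m+n Q R₂) (≤-reflexive (sym e₂)))) (≤-reflexive (sym (*-suc′ P b)))) (*-monoʳ-≤ P b<b′)
    β≡β′ : β ≡ β′
    β≡β′ with <-cmp β β′
    ... | tri< lt _ _ = ⊥-elim (no-< β β′ (p * p′) (p′ * q) (p * r′) (p′ * r) scaled′ scaled pr′<pp′ lt)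
    ... | tri≈ _ eq _ = eq
    ... | tri> _ _ gt = ⊥-elim (no-< β′ β (p * p′) (p′ * q) (p′ * r) (p * r′) scaled scaled′ p′r<pp′ gt)
    p′r≡pr′ : p′ * r ≡ p * r′
    p′r≡pr′ = +-cancelˡ-≡ (p′ * q) _ _ (trans (sym scaled) (trans (cong ((p * p′) *_) β≡β′) scaled′))

  continuant-ratio-injective : ∀ β T β′ T′ → 1 ≤ β → All (2 ≤_) T → 1 ≤ β′ → All (2 ≤_) T′ →
    continuant T * continuant (β′ ∷ T′) ≡ continuant T′ * continuant (β ∷ T) → β ∷ T ≡ β′ ∷ T′
  continuant-ratio-injective β T β′ T′ β≥1 T≥2 β′≥1 T′≥2 cross
    with equal-ratio-division β β′ (continuant T) (continuant T′) (continuant (β ∷ T)) (continuant (β′ ∷ T′)) (remainder T) (remainder T′)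
           (continuant-division β T β≥1 T≥2) (continuant-division β′ T′ β′≥1 T′≥2) (remainder<continuant T T≥2) (remainder<continuant T′ T′≥2) cross
  ... | refl , cross′ = cong (β ∷_) (tails T T′ T≥2 T′≥2 cross′)
    where
    tails : ∀ T T′ → All (2 ≤_) T → All (2 ≤_) T′ → continuant T′ * remainder T ≡ continuant T * remainder T′ → T ≡ T′
    tails [] [] _ _ _ = refl
    tails [] (c ∷ r) _ (_ ∷ r≥2) e =
      ⊥-elim (<-irrefl refl (≤-trans (continuant-positive r r≥2) (≤-reflexive (trans (sym (+-identityʳ (continuant r))) (trans (sym e) (*-zeroʳ (continuant (c ∷ r))))))))
    tails (c ∷ r) [] (_ ∷ r≥2) _ e =
      ⊥-elim (<-irrefl refl (≤-trans (continuant-positive r r≥2) (≤-reflexive (trans (sym (+-identityʳ (continuant r))) (trans e (*-zeroʳ (continuant (c ∷ r))))))))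
    tails (c ∷ r) (c′ ∷ r′) (c≥2 ∷ r≥2) (c′≥2 ∷ r′≥2) e =
      continuant-ratio-injective c r c′ r′ (≤-trans (s≤s z≤n) c≥2) r≥2 (≤-trans (s≤s z≤n) c′≥2) r′≥2
        (trans (*-comm (continuant r) (continuant (c′ ∷ r′))) (trans e (*-comm (continuant (c ∷ r)) (continuant r′))))

module UnitFractions where

  open import Data.Nat as ℕ using (ℕ; zero; suc)
  import Data.Nat.Properties as ℕ
  import Data.Nat.DivMod as ℕ
  open import Data.Nat.GCD using (gcd)
  open import Data.Integer as ℤ using (ℤ; +_; -[1+_]; +<+)
  import Data.Integer.Properties as ℤ
  import Data.Integer.Tactic.RingSolver as ℤ
  open import Data.Rational as ℚ using (ℚ; mkℚ; 0ℚ; 1ℚ; floor)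
  import Data.Rational.Properties as ℚ
  open import Data.Rational.Unnormalised as ℚᵘ using (ℚᵘ; mkℚᵘ; *≡*; *<*)
  import Data.Rational.Unnormalised.Properties as ℚᵘ
  open import Data.List using (_∷_)
  open import Data.Product using (_,_; proj₁)
  open import Data.Empty using (⊥-elim)
  open import Relation.Nullary using (yes; no)
  open import Relation.Binary.PropositionalEquality

  fraction : ℕ → ℕ → ℚ
  fraction p k = (+ p) ℚ./ suc k

  fraction-injective : ∀ p k p′ k′ → fraction p k ≡ fraction p′ k′ → p ℕ.* suc k′ ≡ p′ ℕ.* suc k
  fraction-injective p k p′ k′ = ℚ.normalize-injective-≃ p p′ (suc k) (suc k′)

  fraction-InUnitInterval : ∀ p k → 0 ℕ.< p → p ℕ.< suc k → InUnitInterval (fraction p k)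
  fraction-InUnitInterval p k 0<p p<k = 0<fraction , fraction<1
    where
    toℚᵘ≃ = ℚᵘ.≃-sym (ℚ.toℚᵘ-fromℚᵘ (mkℚᵘ (+ p) k))
    0<fraction : 0ℚ ℚ.< fraction p k
    0<fraction = ℚ.toℚᵘ-cancel-< (ℚᵘ.<-respʳ-≃ toℚᵘ≃
      (*<* (subst₂ ℤ._<_ (sym (ℤ.*-zeroˡ (+ suc k))) (sym (ℤ.*-identityʳ (+ p))) (+<+ 0<p))))
    fraction<1 : fraction p k ℚ.< 1ℚ
    fraction<1 = ℚ.toℚᵘ-cancel-< (ℚᵘ.<-respˡ-≃ toℚᵘ≃
      (*<* (subst₂ ℤ._<_ (sym (ℤ.*-identityʳ (+ p))) (sym (ℤ.*-identityˡ (+ suc k))) (+<+ p<k))))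

  fraction<1⇒< : ∀ p k → fraction p k ℚ.< 1ℚ → p ℕ.< suc k
  fraction<1⇒< p k lt with ℚᵘ.<-respˡ-≃ (ℚ.toℚᵘ-fromℚᵘ (mkℚᵘ (+ p) k)) (ℚ.toℚᵘ-mono-< lt)
  ... | *<* h with subst₂ ℤ._<_ (ℤ.*-identityʳ (+ p)) (ℤ.*-identityˡ (+ suc k)) h
  ... | +<+ p<k = p<k

  floor-InUnitInterval : ∀ g → InUnitInterval g → floor g ≡ + 0
  floor-InUnitInterval (mkℚ (+ n) k _) (_ , ℚ.*<* n<k) with subst₂ ℤ._<_ (ℤ.*-identityʳ (+ n)) (ℤ.*-identityˡ (+ suc k)) n<k
  ... | +<+ n<k′ = trans (ℤ.*-identityˡ (+ (n ℕ./ suc k))) (cong +_ (ℕ.m<n⇒m/n≡0 n<k′))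
  floor-InUnitInterval (mkℚ -[1+ n ] k _) (ℚ.*<* 0<n , _) with subst₂ ℤ._<_ refl (ℤ.*-identityʳ -[1+ n ]) 0<n
  ... | ()

  classQZ-InUnitInterval : ∀ g → InUnitInterval g → classQZ g ≡ g
  classQZ-InUnitInterval g u = trans (cong (λ z → g ℚ.- (z ℚ./ 1)) (floor-InUnitInterval g u)) (ℚ.+-identityʳ g)

  consClass-InUnitInterval : ∀ g γ → InUnitInterval g → consClass g γ ≡ g ∷ γ
  consClass-InUnitInterval g γ u rewrite classQZ-InUnitInterval g u with g ℚ.≟ 0ℚ
  ... | yes g≡0 = ⊥-elim (ℚ.<-irrefl refl (subst (0ℚ ℚ.<_) g≡0 (proj₁ u)))
  ... | no _ = refl

  floor-scaled : ∀ x p q g → ℚ.↥ x ℤ.* + g ≡ + p → ℚ.↧ x ℤ.* + g ≡ + suc q → floor x ≡ + (p ℕ./ suc q)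
  floor-scaled (mkℚ (+ n) d _) p q zero _ e with trans (sym (ℤ.*-zeroʳ (+ suc d))) e
  ... | ()
  floor-scaled (mkℚ (+ n) d _) p q (suc g) num den = trans (ℤ.*-identityˡ (+ (n ℕ./ suc d))) (cong +_ (sym p/q≡n/d))
    where
    num′ : n ℕ.* suc g ≡ p
    num′ = ℤ.+-injective (trans (ℤ.pos-* n (suc g)) num)
    den′ : suc d ℕ.* suc g ≡ suc q
    den′ = ℤ.+-injective (trans (ℤ.pos-* (suc d) (suc g)) den)
    p/q≡n/d : p ℕ./ suc q ≡ n ℕ./ suc d
    p/q≡n/d = trans (ℕ./-congˡ (sym num′)) (trans (ℕ./-congʳ {m = n ℕ.* suc g} {{_}} {{_}} (sym den′)) (ℕ.m*n/o*n≡m/o n (suc g) (suc d)))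
  floor-scaled (mkℚ -[1+ n ] d _) p q (suc g) () _
  floor-scaled (mkℚ -[1+ n ] d _) p q zero _ e with trans (sym (ℤ.*-zeroʳ (+ suc d))) e
  ... | ()

  floor-fraction : ∀ p k → floor (fraction p k) ≡ + (p ℕ./ suc k)
  floor-fraction p k = floor-scaled (fraction p k) p k (gcd p (suc k)) (ℚ.↥-/ (+ p) (suc k)) (ℚ.↧-/ (+ p) (suc k))

  toℚᵘ-fromℚᵘ-minus : ∀ u v → ℚ.toℚᵘ (ℚ.fromℚᵘ u ℚ.- ℚ.fromℚᵘ v) ℚᵘ.≃ (u ℚᵘ.+ (ℚᵘ.- v))
  toℚᵘ-fromℚᵘ-minus u v = ℚᵘ.≃-trans (ℚ.toℚᵘ-homo-+ (ℚ.fromℚᵘ u) (ℚ.- ℚ.fromℚᵘ v))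
    (ℚᵘ.≃-trans (ℚᵘ.+-congʳ (ℚ.toℚᵘ (ℚ.fromℚᵘ u)) (ℚ.toℚᵘ-homo‿- (ℚ.fromℚᵘ v)))
      (ℚᵘ.+-cong (ℚ.toℚᵘ-fromℚᵘ u) (ℚᵘ.-‿cong (ℚ.toℚᵘ-fromℚᵘ v))))

  classQZ-fraction-+ : ∀ k r → classQZ (fraction (suc k ℕ.+ r) k) ≡ classQZ (fraction r k)
  classQZ-fraction-+ k r = ℚ.toℚᵘ-injective (begin
      ℚ.toℚᵘ (fraction (suc k ℕ.+ r) k ℚ.- (floor (fraction (suc k ℕ.+ r) k) ℚ./ 1)) ≡⟨ cong (λ z → ℚ.toℚᵘ (fraction (suc k ℕ.+ r) k ℚ.- (z ℚ./ 1))) floor≡ ⟩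
      ℚ.toℚᵘ (fraction (suc k ℕ.+ r) k ℚ.- (+ suc t ℚ./ 1))                         ≈⟨ toℚᵘ-fromℚᵘ-minus (mkℚᵘ (+ (suc k ℕ.+ r)) k) (mkℚᵘ (+ suc t) 0) ⟩
      mkℚᵘ (+ (suc k ℕ.+ r)) k ℚᵘ.+ (ℚᵘ.- mkℚᵘ (+ suc t) 0)                         ≈⟨ *≡* (cong (ℤ._* (+ suc (k ℕ.* 1))) (drop-one (+ k) (+ r) (+ t))) ⟩
      mkℚᵘ (+ r) k ℚᵘ.+ (ℚᵘ.- mkℚᵘ (+ t) 0)                                         ≈⟨ ℚᵘ.≃-sym (toℚᵘ-fromℚᵘ-minus (mkℚᵘ (+ r) k) (mkℚᵘ (+ t) 0)) ⟩
      ℚ.toℚᵘ (fraction r k ℚ.- (+ t ℚ./ 1))                                          ≡⟨ cong (λ z → ℚ.toℚᵘ (fraction r k ℚ.- (z ℚ./ 1))) (sym (floor-fraction r k)) ⟩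
      ℚ.toℚᵘ (fraction r k ℚ.- (floor (fraction r k) ℚ./ 1)) ∎)
    where
    open ℚᵘ.≃-Reasoning
    t = r ℕ./ suc k
    floor≡ : floor (fraction (suc k ℕ.+ r) k) ≡ + suc t
    floor≡ = trans (floor-fraction (suc k ℕ.+ r) k)
      (cong +_ (trans (ℕ.m/n≡1+[m∸n]/n (ℕ.m≤m+n (suc k) r)) (cong (λ z → suc (z ℕ./ suc k)) (ℕ.m+n∸m≡n (suc k) r))))
    drop-one : ∀ K R T → (ℤ.+ 1 ℤ.+ K ℤ.+ R) ℤ.* ℤ.+ 1 ℤ.+ (ℤ.- (ℤ.+ 1 ℤ.+ T)) ℤ.* (ℤ.+ 1 ℤ.+ K) ≡ R ℤ.* ℤ.+ 1 ℤ.+ (ℤ.- T) ℤ.* (ℤ.+ 1 ℤ.+ K)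
    drop-one = ℤ.solve-∀

module BlockValue where

  open Continuant
  open UnitFractions
  open BlockLayout using (Block₂)
  open import Data.Nat using (ℕ; zero; suc; z≤n; s≤s; _+_; _*_; _∸_; _≤_; _<_)
  open import Data.Nat.Properties
  open import Data.Integer using (+_)
  open import Data.Rational as ℚ using (ℚ; 1ℚ)
  import Data.Rational.Properties as ℚ
  open import Data.List using (List; []; _∷_; map)
  import Data.List.Properties as List
  open import Data.List.Relation.Unary.All using (All; []; _∷_)
  open import Data.Product using (Σ; _×_; _,_)
  open import Data.Empty using (⊥-elim)
  open import Relation.Binary.PropositionalEquality

  frac-suc : ∀ a b → 1 ≤ b → Σ ℕ λ q → b ≡ suc q × frac (+ a) (+ b) ≡ fraction a q
  frac-suc a (suc q) _ = q , refl , refl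

  ⟨⟩≡fraction : ∀ β T → 1 ≤ β → All (2 ≤_) T → Σ ℕ λ q → continuant (β ∷ T) ≡ suc q × ⟨ β ∷ T ⟩ ≡ fraction (continuant T) q
  ⟨⟩≡fraction β T β≥1 T≥2 with frac-suc (continuant T) (continuant (β ∷ T)) (continuant-∷-positive β T β≥1 T≥2)
  ... | q , e , f = q , e , trans (cong₂ frac (D≡continuant₀ T T≥2) (D≡continuant β T β≥1 T≥2)) f
    where
    D≡continuant₀ : ∀ T → All (2 ≤_) T → D T ≡ + continuant T
    D≡continuant₀ [] _ = refl
    D≡continuant₀ (c ∷ T) (c≥2 ∷ T≥2) = D≡continuant c T (≤-trans (s≤s z≤n) c≥2) T≥2

  ⟨⟩-InUnitInterval : ∀ β T → 2 ≤ β → All (2 ≤_) T → InUnitInterval ⟨ β ∷ T ⟩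
  ⟨⟩-InUnitInterval β T β≥2 T≥2 with ⟨⟩≡fraction β T (≤-trans (s≤s z≤n) β≥2) T≥2
  ... | q , e , f = subst InUnitInterval (sym f)
    (fraction-InUnitInterval (continuant T) q (continuant-positive T T≥2) (subst (continuant T <_) e (continuant-<-∷ β T β≥2 T≥2)))

  Block₂⇒𝒜₁ : ∀ {B} → Block₂ B → 𝒜₁ B
  Block₂⇒𝒜₁ ((β , T , refl) , β≥2 ∷ T≥2) = ≤-trans (s≤s z≤n) β≥2 , T≥2

  Block₂⇒InUnitInterval : ∀ {B} → Block₂ B → InUnitInterval ⟨ B ⟩
  Block₂⇒InUnitInterval ((β , T , refl) , β≥2 ∷ T≥2) = ⟨⟩-InUnitInterval β T β≥2 T≥2

  piOfBlocks-Block₂ : ∀ Bs → All Block₂ Bs → piOfBlocks Bs ≡ map ⟨_⟩ Bs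
  piOfBlocks-Block₂ [] [] = refl
  piOfBlocks-Block₂ (B ∷ Bs) (block ∷ _) = consClass-InUnitInterval ⟨ B ⟩ (map ⟨_⟩ Bs) (Block₂⇒InUnitInterval block)

  ⟨⟩-injective : ∀ B B′ → 𝒜₁ B → 𝒜₁ B′ → ⟨ B ⟩ ≡ ⟨ B′ ⟩ → B ≡ B′
  ⟨⟩-injective (β ∷ T) (β′ ∷ T′) (β≥1 , T≥2) (β′≥1 , T′≥2) e with ⟨⟩≡fraction β T β≥1 T≥2 | ⟨⟩≡fraction β′ T′ β′≥1 T′≥2
  ... | q , eq , f | q′ , eq′ , f′ =
    continuant-ratio-injective β T β′ T′ β≥1 T≥2 β′≥1 T′≥2
      (trans (cong (continuant T *_) eq′) (trans (fraction-injective (continuant T) q (continuant T′) q′ (trans (sym f) (trans e f′))) (cong (continuant T′ *_) (sym eq))))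

  map-⟨⟩-injective : ∀ Bs Bs′ → All 𝒜₁ Bs → All 𝒜₁ Bs′ → map ⟨_⟩ Bs ≡ map ⟨_⟩ Bs′ → Bs ≡ Bs′
  map-⟨⟩-injective [] [] _ _ _ = refl
  map-⟨⟩-injective (B ∷ Bs) (B′ ∷ Bs′) (a ∷ as) (a′ ∷ as′) e =
    cong₂ _∷_ (⟨⟩-injective B B′ a a′ (List.∷-injectiveˡ e)) (map-⟨⟩-injective Bs Bs′ as as′ (List.∷-injectiveʳ e))

  ⟨⟩<1⇒Block₂ : ∀ B → 𝒜₁ B → ⟨ B ⟩ ℚ.< 1ℚ → Block₂ B
  ⟨⟩<1⇒Block₂ (suc zero ∷ []) _ lt = ⊥-elim (ℚ.<-irrefl refl lt)
  ⟨⟩<1⇒Block₂ (suc zero ∷ c ∷ r) (β≥1 , T≥2) lt with ⟨⟩≡fraction 1 (c ∷ r) β≥1 T≥2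
  ... | q , e , f = ⊥-elim (<-irrefl refl (<-≤-trans (fraction<1⇒< (continuant (c ∷ r)) q (subst (ℚ._< 1ℚ) f lt))
        (≤-trans (≤-reflexive (sym e)) (≤-trans (m∸n≤m (1 * continuant (c ∷ r)) (continuant r)) (≤-reflexive (*-identityˡ _))))))
  ⟨⟩<1⇒Block₂ (suc (suc b) ∷ T) (_ , T≥2) _ = (suc (suc b) , T , refl) , s≤s (s≤s z≤n) ∷ T≥2

  classQZ-⟨1∷⟩ : ∀ a C → 1 ≤ a → All (2 ≤_) C → classQZ ⟨ 1 ∷ suc a ∷ C ⟩ ≡ classQZ ⟨ a ∷ C ⟩
  classQZ-⟨1∷⟩ a C a≥1 C≥2 with ⟨⟩≡fraction a C a≥1 C≥2 | ⟨⟩≡fraction 1 (suc a ∷ C) (s≤s z≤n) (s≤s a≥1 ∷ C≥2)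
  ... | q , e , f | q₁ , e₁ , f₁ = begin
    classQZ ⟨ 1 ∷ suc a ∷ C ⟩                  ≡⟨ cong classQZ f₁ ⟩
    classQZ (fraction (continuant (suc a ∷ C)) q₁) ≡⟨ cong classQZ (cong₂ fraction numerator≡ q₁≡q) ⟩
    classQZ (fraction (suc q + continuant C) q) ≡⟨ classQZ-fraction-+ q (continuant C) ⟩
    classQZ (fraction (continuant C) q)        ≡⟨ cong classQZ (sym f) ⟩
    classQZ ⟨ a ∷ C ⟩ ∎
    where
    open ≡-Reasoning
    numerator≡ : continuant (suc a ∷ C) ≡ suc q + continuant C
    numerator≡ = trans (continuant-suc a C a≥1 C≥2) (cong (_+ continuant C) e)
    q₁≡q : q₁ ≡ q
    q₁≡q = suc-injective (begin
      suc q₁                                  ≡⟨ sym e₁ ⟩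
      1 * continuant (suc a ∷ C) ∸ continuant C ≡⟨ cong (_∸ continuant C) (*-identityˡ _) ⟩
      continuant (suc a ∷ C) ∸ continuant C    ≡⟨ cong (_∸ continuant C) numerator≡ ⟩
      suc q + continuant C ∸ continuant C      ≡⟨ m+n∸n≡m (suc q) (continuant C) ⟩
      suc q ∎)

module Reductions where

  open Zeckendorf
  open Parity
  open BlockLayout
  open CanonicalForm
  open BlockValue
  open import Data.Nat using (ℕ; zero; suc; z≤n; s≤s; _+_; _∸_; _≤_; _<_; _/_)
  open import Data.Nat.Properties
  open import Data.List using (List; []; _∷_; [_]; map; zip)
  open import Data.List.Relation.Unary.All as All using (All; []; _∷_)
  import Data.List.Relation.Unary.All.Properties as All
  open import Data.List.Relation.Unary.Linked using (Linked; []; _∷_)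
  open import Data.Product using (Σ; _×_; _,_; proj₁; proj₂)
  open import Data.Sum using (_⊎_; inj₁; inj₂)
  open import Data.Empty using (⊥-elim)
  open import Data.Bool using (true; false; if_then_else_)
  import Data.Rational as ℚ
  open import Relation.Nullary using (does)
  open import Relation.Binary.PropositionalEquality hiding ([_]; J)

  SmallerPreimage : ℕ → Γ → Set
  SmallerPreimage k γ = Σ ℕ λ k′ → k′ < k × IsPi k′ γ

  assocVecFrom-map-+ : ∀ c p R → assocVecFrom (c + p) (map (c +_) R) ≡ assocVecFrom p R
  assocVecFrom-map-+ c p [] = refl
  assocVecFrom-map-+ c p (i ∷ R) = cong₂ _∷_ (cong (λ z → z / 2 + 1) ([m+n]∸[m+o]≡n∸o c i p)) (assocVecFrom-map-+ c i R)

  zip-map-+ : ∀ c (I A : List ℕ) → zip (map (c +_) I) A ≡ map (shiftIndex c) (zip I A)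
  zip-map-+ c [] A = refl
  zip-map-+ c (i ∷ I) [] = refl
  zip-map-+ c (i ∷ I) (a ∷ A) = cong ((c + i , a) ∷_) (zip-map-+ c I A)

  runs-tail-map-+ : ∀ c p R acc → runsAcc (c + p) acc (zip (map (c +_) R) (assocVecFrom (c + p) (map (c +_) R))) ≡ runsAcc p acc (zip R (assocVecFrom p R))
  runs-tail-map-+ c p R acc =
    trans (cong (runsAcc (c + p) acc) (trans (cong (zip (map (c +_) R)) (assocVecFrom-map-+ c p R)) (zip-map-+ c R _))) (runsAcc-shift c p acc (zip R (assocVecFrom p R)))

  -- moving an odd least element 2h + 1 up to 2h + 2 keeps α₁ = h + 1
  𝒱-map-suc : ∀ h R → 𝒱 (map (1 +_) (suc (double h) ∷ R)) ≡ 𝒱 (suc (double h) ∷ R)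
  𝒱-map-suc h R =
    trans (cong (λ z → runsAcc (1 + suc (double h)) [ z + 1 ] (zip (map (1 +_) R) (assocVecFrom (1 + suc (double h)) (map (1 +_) R)))) half≡)
      (runs-tail-map-+ 1 (suc (double h)) R _)
    where
    half≡ : suc (double h) / 2 ≡ double h / 2
    half≡ = trans (cong (λ z → suc z / 2) (double≡2* h)) (trans ([1+2*k]/2≡k h) (sym (trans (cong (_/ 2) (double≡2* h)) (2*k/2≡k h))))

  𝒱-even : ∀ h R → All (1 ≤_) R → 𝒱 (suc (suc (double h)) ∷ R) ≡ 𝒱 (suc (double h) ∷ map (_∸ 1) R)
  𝒱-even h R R≥1 = trans (cong 𝒱 (sym (map-+-∸ 1 (suc (suc (double h)) ∷ R) (s≤s z≤n ∷ R≥1)))) (𝒱-map-suc h (map (_∸ 1) R))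

  smaller-preimage-even : ∀ h R k → IsZ k (suc (suc (double h)) ∷ R) → SmallerPreimage k (piOfBlocks (𝒱 (suc (suc (double h)) ∷ R)))
  smaller-preimage-even h R k ((_ ∷ R≥1 , linked) , sum≡) = fsum I′ , fsum<k , I′ , (twoPartition , refl) , cong piOfBlocks (sym (𝒱-even h R R≥1))
    where
    I′ = suc (double h) ∷ map (_∸ 1) R
    R≥2 : All (2 ≤_) R
    R≥2 = Linked-gap-lower-bound (m≤n+m 2 (suc (suc (double h)))) linked
    twoPartition : TwoPartition I′
    twoPartition = (s≤s z≤n ∷ All.map⁺ (All.map (∸-monoˡ-≤ 1) R≥2)) , Linked-gap-map-∸ 1 (s≤s z≤n ∷ R≥1) linked
    fsum<k : fsum I′ < k
    fsum<k = subst (fsum I′ <_) sum≡ (+-mono-<-≤ (fib-suc-< (double h)) (fsum-map-∸ 1 R))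

  Block₂Decomposition : List ℕ → Set
  Block₂Decomposition I = Σ (List ℕ) λ B → Σ (List (List ℕ)) λ Bs → 𝒱 I ≡ B ∷ Bs × All Block₂ (B ∷ Bs) × ε (B ∷ Bs) ≡ I

  block₂-decomposition : ∀ h L → Linked Gap (suc (double (suc h)) ∷ L) → Block₂Decomposition (suc (double (suc h)) ∷ L)
  block₂-decomposition h L linked =
    let B , Bs , B≥2 , blocks , 𝒱≡ , ε≡ = odd-decomposition (suc h) L linked
    in suc (suc h) ∷ B , Bs , 𝒱≡ , ((suc (suc h) , B , refl) , s≤s (s≤s z≤n) ∷ B≥2) ∷ blocks , ε≡

  piOfBlocks-𝒱-Block₂ : ∀ {I} → (dec : Block₂Decomposition I) → piOfBlocks (𝒱 I) ≡ map ⟨_⟩ (proj₁ dec ∷ proj₁ (proj₂ dec))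
  piOfBlocks-𝒱-Block₂ (B , Bs , 𝒱≡ , blocks , _) = trans (cong piOfBlocks 𝒱≡) (piOfBlocks-Block₂ (B ∷ Bs) blocks)

  runsAcc-same-run : ∀ p acc i a xs → sameParity p i ≡ true → runsAcc p acc ((i , a) ∷ xs) ≡ runsAcc p (a ∷ acc) xs
  runsAcc-same-run p acc i a xs e rewrite e = refl

  𝒱-1∷ : ∀ j R → sameParity 1 j ≡ false → 𝒱 (1 ∷ j ∷ R) ≡ [ 1 ] ∷ 𝒱 (j ∷ R)
  𝒱-1∷ j R e rewrite e = refl

  consClass-⟨[1]⟩ : ∀ γ → consClass ⟨ [ 1 ] ⟩ γ ≡ γ
  consClass-⟨[1]⟩ γ = refl

  smaller-preimage-[1] : ∀ k → IsZ k [ 1 ] → SmallerPreimage k (piOfBlocks (𝒱 [ 1 ]))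
  smaller-preimage-[1] k (_ , sum≡) = 0 , subst (0 <_) sum≡ (s≤s z≤n) , [] , (([] , []) , refl) , refl

  smaller-preimage-1∷even : ∀ h R k → IsZ k (1 ∷ suc (suc (double (suc h))) ∷ R) →
    SmallerPreimage k (piOfBlocks (𝒱 (1 ∷ suc (suc (double (suc h))) ∷ R)))
  smaller-preimage-1∷even h R k ((_ ∷ J≥1 , _ ∷ linked) , sum≡) =
    fsum J , subst (fsum J <_) sum≡ (n<1+n (fsum J)) , J , ((J≥1 , linked) , refl) , π≡
    where
    J = suc (suc (double (suc h))) ∷ R
    R≥2 : All (2 ≤_) R
    R≥2 = Linked-gap-lower-bound (m≤n+m 2 (suc (suc (double (suc h))))) linked
    decomposition = block₂-decomposition h (map (_∸ 1) R) (Linked-gap-map-∸ 1 (s≤s z≤n ∷ All.map (≤-trans (s≤s z≤n)) R≥2) linked)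
    Bs = proj₁ decomposition ∷ proj₁ (proj₂ decomposition)
    𝒱J≡ : 𝒱 J ≡ Bs
    𝒱J≡ = trans (𝒱-even (suc h) R (All.map (≤-trans (s≤s z≤n)) R≥2)) (proj₁ (proj₂ (proj₂ decomposition)))
    π≡ : piOfBlocks (𝒱 J) ≡ piOfBlocks (𝒱 (1 ∷ J))
    π≡ = begin
      piOfBlocks (𝒱 J)         ≡⟨ cong piOfBlocks 𝒱J≡ ⟩
      piOfBlocks Bs            ≡⟨ piOfBlocks-Block₂ Bs (proj₁ (proj₂ (proj₂ (proj₂ decomposition)))) ⟩
      map ⟨_⟩ Bs               ≡⟨ sym (consClass-⟨[1]⟩ (map ⟨_⟩ Bs)) ⟩
      piOfBlocks ([ 1 ] ∷ Bs)  ≡⟨ cong (λ z → piOfBlocks ([ 1 ] ∷ z)) (sym 𝒱J≡) ⟩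
      piOfBlocks ([ 1 ] ∷ 𝒱 J) ≡⟨ cong piOfBlocks (sym (𝒱-1∷ (suc (suc (double (suc h)))) R (sameParity-false {1} {suc (suc (double (suc h)))} (sym (parity-odd (suc (suc h))))))) ⟩
      piOfBlocks (𝒱 (1 ∷ J)) ∎
      where open ≡-Reasoning

  consClass-cong : ∀ p p′ γ → classQZ p ≡ classQZ p′ → consClass p γ ≡ consClass p′ γ
  consClass-cong _ _ γ = cong (λ z → if does (z ℚ.≟ ℚ.0ℚ) then γ else z ∷ γ)

  glueHead-1∷ : ∀ a W α C Rest → glueHead [ a ] W ≡ (α ∷ C) ∷ Rest → glueHead (1 ∷ suc a ∷ []) W ≡ (1 ∷ suc α ∷ C) ∷ Rest
  glueHead-1∷ a [] α C Rest refl = refl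
  glueHead-1∷ a (B ∷ W) α C Rest refl = refl

  -- 1 and 2h + 3 lie in one run, contributing (1, h + 2) where 2h + 1 alone gives h + 1
  𝒱-1∷odd : ∀ h R α C Rest → All (2 ≤_) R → 𝒱 (suc (double h) ∷ map (_∸ 2) R) ≡ (α ∷ C) ∷ Rest →
    𝒱 (1 ∷ suc (suc (suc (double h))) ∷ R) ≡ (1 ∷ suc α ∷ C) ∷ Rest
  𝒱-1∷odd h R α C Rest R≥2 𝒱I′≡ = begin
    𝒱 (1 ∷ i ∷ R)                                          ≡⟨ cong (λ z → 𝒱 (1 ∷ i ∷ z)) (sym (map-+-∸ 2 R R≥2)) ⟩
    runsAcc 1 [ 1 ] ((i , α′) ∷ zip (map (2 +_) M) (assocVecFrom i (map (2 +_) M))) ≡⟨ runsAcc-same-run 1 [ 1 ] i α′ X (sameParity-true {1} {i} (sym (parity-odd (suc h)))) ⟩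
    runsAcc 1 (α′ ∷ [ 1 ]) (zip (map (2 +_) M) (assocVecFrom i (map (2 +_) M))) ≡⟨ runsAcc-glueHead 1 (α′ ∷ [ 1 ]) X ⟩
    glueHead (1 ∷ α′ ∷ []) (runsAcc 1 [] (zip (map (2 +_) M) (assocVecFrom i (map (2 +_) M))))
      ≡⟨ cong (glueHead (1 ∷ α′ ∷ [])) (trans (runsAcc-parity 1 i [] X (sym (parity-odd (suc h)))) (runs-tail-map-+ 2 i₀ M [])) ⟩
    glueHead (1 ∷ α′ ∷ []) W                                 ≡⟨ cong (λ z → glueHead (1 ∷ z + 1 ∷ []) W) ([2+m]/2≡1+m/2 (double h)) ⟩
    glueHead (1 ∷ suc α₀ ∷ []) W                             ≡⟨ glueHead-1∷ α₀ W α C Rest (trans (sym (runsAcc-glueHead i₀ [ α₀ ] M′)) 𝒱I′≡) ⟩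
    (1 ∷ suc α ∷ C) ∷ Rest ∎
    where
    open ≡-Reasoning
    i₀ = suc (double h)
    i = suc (suc i₀)
    M = map (_∸ 2) R
    M′ = zip M (assocVecFrom i₀ M)
    X = zip (map (2 +_) M) (assocVecFrom i (map (2 +_) M))
    W = runsAcc i₀ [] M′
    α₀ = double h / 2 + 1
    α′ = suc (suc (double h)) / 2 + 1

  smaller-preimage-1∷odd : ∀ h R k → IsZ k (1 ∷ suc (suc (suc (double h))) ∷ R) →
    SmallerPreimage k (piOfBlocks (𝒱 (1 ∷ suc (suc (suc (double h))) ∷ R)))
  smaller-preimage-1∷odd h R k ((_ ∷ _ ∷ R≥1 , _ ∷ linked) , sum≡) = fsum I′ , fsum<k , I′ , ((I′≥1 , linked′) , refl) , sym π≡
    where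
    I′ = suc (double h) ∷ map (_∸ 2) R
    R≥2 : All (2 ≤_) R
    R≥2 = Linked-gap-lower-bound (m≤n+m 2 (suc (suc (suc (double h))))) linked
    R≥3 : All (3 ≤_) R
    R≥3 = Linked-gap-lower-bound (≤-trans (s≤s (s≤s (s≤s z≤n))) (m≤m+n (suc (suc (suc (double h)))) 2)) linked
    linked′ = Linked-gap-map-∸ 2 (s≤s (s≤s z≤n) ∷ R≥2) linked
    I′≥1 : All (1 ≤_) I′
    I′≥1 = s≤s z≤n ∷ All.map⁺ (All.map (∸-monoˡ-≤ 2) R≥3)
    fsum<k : fsum I′ < k
    fsum<k = subst (fsum I′ <_) sum≡ (s≤s (+-mono-≤ (fib-mono-≤ {suc (double h)} {suc (suc (suc (double h)))} (≤-trans (n≤1+n _) (n≤1+n _))) (fsum-map-∸ 2 R)))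
    π≡ : piOfBlocks (𝒱 (1 ∷ suc (suc (suc (double h))) ∷ R)) ≡ piOfBlocks (𝒱 I′)
    π≡ =
      let B , Bs′ , B≥2 , _ , 𝒱I′≡ , _ = odd-decomposition h (map (_∸ 2) R) linked′
      in begin
        piOfBlocks (𝒱 (1 ∷ suc (suc (suc (double h))) ∷ R)) ≡⟨ cong piOfBlocks (𝒱-1∷odd h R (suc h) B Bs′ R≥2 𝒱I′≡) ⟩
        consClass ⟨ 1 ∷ suc (suc h) ∷ B ⟩ (map ⟨_⟩ Bs′)  ≡⟨ consClass-cong ⟨ 1 ∷ suc (suc h) ∷ B ⟩ ⟨ suc h ∷ B ⟩ (map ⟨_⟩ Bs′) (classQZ-⟨1∷⟩ (suc h) B (s≤s z≤n) B≥2) ⟩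
        consClass ⟨ suc h ∷ B ⟩ (map ⟨_⟩ Bs′)            ≡⟨ cong piOfBlocks (sym 𝒱I′≡) ⟩
        piOfBlocks (𝒱 I′) ∎
      where open ≡-Reasoning

  reducible-1∷ : ∀ k R → IsZ k (1 ∷ R) → SmallerPreimage k (piOfBlocks (𝒱 (1 ∷ R)))
  reducible-1∷ k [] isZ = smaller-preimage-[1] k isZ
  reducible-1∷ k (j ∷ R) isZ@((_ , 3≤j ∷ _) , _) with parity-view j
  ... | zero , inj₁ refl = ⊥-elim (n≮0 3≤j)
  ... | suc zero , inj₁ refl = ⊥-elim (n≮0 (≤-pred (≤-pred 3≤j)))
  ... | suc (suc h) , inj₁ refl = smaller-preimage-1∷even h R k isZ
  ... | zero , inj₂ refl = ⊥-elim (n≮0 (≤-pred 3≤j))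
  ... | suc h , inj₂ refl = smaller-preimage-1∷odd h R k isZ

  reducible-unless-odd : ∀ k i R → IsZ k (i ∷ R) →
    (Σ ℕ λ h → i ≡ suc (double (suc h))) ⊎ SmallerPreimage k (piOfBlocks (𝒱 (i ∷ R)))
  reducible-unless-odd k i R isZ@((i≥1 ∷ _ , _) , _) with parity-view i
  ... | zero , inj₁ refl = ⊥-elim (1+n≰n i≥1)
  ... | suc h , inj₁ refl = inj₂ (smaller-preimage-even h R k isZ)
  ... | zero , inj₂ refl = inj₂ (reducible-1∷ k R isZ)
  ... | suc h , inj₂ refl = inj₁ (h , refl)

module Theta where

  open Zeckendorf
  open Parity
  open BlockLayout
  open CanonicalForm
  open BlockValue
  open UnitFractions
  open Reductions
  open import Data.Nat using (ℕ; zero; suc; z≤n; s≤s; _≤_; _<_)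
  open import Data.Nat.Properties
  open import Data.Nat.Induction using (<-rec)
  open import Data.Nat.Divisibility using (_∣_; divides; n∣m⇒m%n≡0)
  open import Data.Rational using (ℚ)
  open import Data.List using (List; []; _∷_; map)
  open import Data.List.Relation.Unary.All as All using (All; []; _∷_)
  open import Data.Product using (Σ; _×_; _,_; proj₂)
  open import Data.Sum using (_⊎_; inj₁; inj₂)
  open import Data.Empty using (⊥-elim)
  open import Relation.Nullary using (¬_)
  open import Relation.Binary.PropositionalEquality hiding ([_])
  open import Function.Bundles using (_⇔_; mk⇔)

  All-InUnitInterval⇒Block₂ : ∀ Bs → All 𝒜₁ Bs → All InUnitInterval (map ⟨_⟩ Bs) → All Block₂ Bs
  All-InUnitInterval⇒Block₂ [] [] [] = []
  All-InUnitInterval⇒Block₂ (B ∷ Bs) (a ∷ as) (u ∷ us) = ⟨⟩<1⇒Block₂ B a (proj₂ u) ∷ All-InUnitInterval⇒Block₂ Bs as us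

  All-Block₂⇒Canonical : ∀ {B Bs} → All Block₂ (B ∷ Bs) → Canonical (B ∷ Bs)
  All-Block₂⇒Canonical (((β , T , refl) , β≥2 ∷ T≥2) ∷ blocks) = β , T , _ , refl , ≤-trans (s≤s z≤n) β≥2 , T≥2 , blocks

  IsPi-ε : ∀ {B Bs} → All Block₂ (B ∷ Bs) → IsPi (fsum (ε (B ∷ Bs))) (map ⟨_⟩ (B ∷ Bs))
  IsPi-ε {B} {Bs} blocks =
    ε (B ∷ Bs) , (TwoPartition-ε canonical , refl) , trans (cong piOfBlocks (𝒱-ε canonical)) (piOfBlocks-Block₂ (B ∷ Bs) blocks)
    where canonical = All-Block₂⇒Canonical blocks

  canonical-preimage : ∀ k h R Bs → IsZ k (suc (double (suc h)) ∷ R) → All Block₂ Bs →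
    piOfBlocks (𝒱 (suc (double (suc h)) ∷ R)) ≡ map ⟨_⟩ Bs → fsum (ε Bs) ≡ k
  canonical-preimage k h R Bs ((_ , linked) , sum≡) blocks π≡ =
    let dec@(C , Cs , _ , blocksC , εC≡) = block₂-decomposition h R linked
        Cs≡Bs = map-⟨⟩-injective (C ∷ Cs) Bs (All.map Block₂⇒𝒜₁ blocksC) (All.map Block₂⇒𝒜₁ blocks)
                  (trans (sym (piOfBlocks-𝒱-Block₂ dec)) π≡)
    in trans (cong (λ Xs → fsum (ε Xs)) (sym Cs≡Bs)) (trans (cong fsum εC≡) sum≡)

  θ-ε : ∀ B Bs → All Block₂ (B ∷ Bs) → IsTheta (map ⟨_⟩ (B ∷ Bs)) (fsum (ε (B ∷ Bs)))
  θ-ε B Bs blocks = IsPi-ε blocks , λ k k<N isPi → <⇒≱ k<N (<-rec (λ k → IsPi k γ → N ≤ k) minimal k isPi)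
    where
    γ = map ⟨_⟩ (B ∷ Bs)
    N = fsum (ε (B ∷ Bs))
    minimal : ∀ k → (∀ {k′} → k′ < k → IsPi k′ γ → N ≤ k′) → IsPi k γ → N ≤ k
    minimal k _ ([] , _ , ())
    minimal k rec (i ∷ R , isZ , π≡) = by-cases (reducible-unless-odd k i R isZ)
      where
      by-cases : (Σ ℕ λ h → i ≡ suc (double (suc h))) ⊎ SmallerPreimage k (piOfBlocks (𝒱 (i ∷ R))) → N ≤ k
      by-cases (inj₁ (h , refl)) = ≤-reflexive (canonical-preimage k h R (B ∷ Bs) isZ blocks π≡)
      by-cases (inj₂ (k′ , k′<k , J , isZ′ , π′≡)) = ≤-trans (rec k′<k (J , isZ′ , trans π′≡ π≡)) (<⇒≤ k′<k)

  θ≡fsum-ε : (g : ℚ) (gs : Γ) → All InUnitInterval (g ∷ gs) →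
    (Bs : List (List ℕ)) → All 𝒜₁ Bs → map ⟨_⟩ Bs ≡ g ∷ gs → IsTheta (g ∷ gs) (fsum (ε Bs))
  θ≡fsum-ε g gs _ [] _ ()
  θ≡fsum-ε g gs units (B ∷ Bs) admissible c≡ =
    subst (λ γ → IsTheta γ (fsum (ε (B ∷ Bs)))) c≡
      (θ-ε B Bs (All-InUnitInterval⇒Block₂ (B ∷ Bs) admissible (subst (All InUnitInterval) (sym c≡) units)))

  CanonicalMu1 : ℕ → Set
  CanonicalMu1 n = Σ ℕ λ i → IsMu1 n i × ¬ (2 ∣ i) × 3 ≤ i

  odd⇒¬2∣ : ∀ h → ¬ (2 ∣ suc (double h))
  odd⇒¬2∣ h 2∣ = 1≢0 (trans (sym (parity-odd h)) (trans (sym (%2≡parity (suc (double h)))) (n∣m⇒m%n≡0 (suc (double h)) 2 2∣)))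
    where
    1≢0 : ¬ (1 ≡ 0)
    1≢0 ()

  2∣double : ∀ h → 2 ∣ double h
  2∣double h = divides h (trans (double≡2* h) (*-comm 2 h))

  CanonicalMu1-view : ∀ {n} → CanonicalMu1 n → Σ ℕ λ h → Σ (List ℕ) λ R → IsZ n (suc (double (suc h)) ∷ R)
  CanonicalMu1-view (i , (R , isZ) , ¬2∣i , 3≤i) with parity-view i
  ... | h , inj₁ refl = ⊥-elim (¬2∣i (2∣double h))
  ... | zero , inj₂ refl = ⊥-elim (n≮0 (≤-pred 3≤i))
  ... | suc h , inj₂ refl = h , R , isZ

  essential-0 : Essential 0
  essential-0 γ isPi = isPi , λ _ k<0 _ → n≮0 k<0

  essential⇒CanonicalMu1 : ∀ n → Essential n → n ≡ 0 ⊎ CanonicalMu1 n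
  essential⇒CanonicalMu1 zero _ = inj₁ refl
  essential⇒CanonicalMu1 (suc m) essential with zeckendorf-exists (suc m)
  ... | [] , (_ , ())
  ... | i ∷ R , isZ with reducible-unless-odd (suc m) i R isZ
  ...   | inj₁ (h , refl) = inj₂ (i , (R , isZ) , odd⇒¬2∣ (suc h) , s≤s (s≤s (s≤s z≤n)))
  ...   | inj₂ (k′ , k′<n , isPi′) = ⊥-elim (proj₂ (essential _ (i ∷ R , isZ , refl)) k′ k′<n isPi′)

  CanonicalMu1⇒essential : ∀ n → n ≡ 0 ⊎ CanonicalMu1 n → Essential n
  CanonicalMu1⇒essential n (inj₁ refl) = essential-0
  CanonicalMu1⇒essential n (inj₂ canonical) γ (J , isZJ , π≡) =
    let h , R , isZ@((_ , linked) , sum≡) = CanonicalMu1-view canonical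
        dec@(C , Cs , _ , blocks , ε≡) = block₂-decomposition h R linked
    in subst₂ IsTheta
         (trans (sym (piOfBlocks-𝒱-Block₂ dec)) (trans (cong (λ X → piOfBlocks (𝒱 X)) (zeckendorf-unique isZ isZJ)) π≡))
         (trans (cong fsum ε≡) sum≡)
         (θ-ε C Cs blocks)

  essential⇔CanonicalMu1 : (n : ℕ) → Essential n ⇔ (n ≡ 0 ⊎ CanonicalMu1 n)
  essential⇔CanonicalMu1 n = mk⇔ (essential⇒CanonicalMu1 n) (CanonicalMu1⇒essential n)

module Wythoff where

  open Zeckendorf
  open Parity
  open ShiftedFsum
  open GoldenFloor
  open Theta
  open import Data.Nat using (ℕ; zero; suc; z≤n; s≤s; _+_; _∸_; _≤_; _<_)
  open import Data.Nat.Properties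
  open import Data.Nat.Tactic.RingSolver using (solve-∀)
  open import Data.List using (List; []; _∷_; [_]; map; _++_)
  import Data.List.Properties as List
  open import Data.List.Relation.Unary.All as All using (All; []; _∷_)
  import Data.List.Relation.Unary.All.Properties as All
  open import Data.List.Relation.Unary.Linked using (Linked; [-]; _∷_)
  open import Data.Product using (Σ; _×_; _,_)
  open import Data.Sum using (_⊎_; inj₁; inj₂)
  open import Data.Empty using (⊥-elim)
  open import Relation.Binary.PropositionalEquality hiding ([_])
  open import Function.Bundles using (_⇔_; mk⇔)

  Wythoff : ℕ → Set
  Wythoff n = Σ ℕ λ m → Σ ℕ λ a → Σ ℕ λ b → IsFloorMulTau m a × IsFloorMulTau² m b × n ≡ a + b

  floorMulτ-0 : IsFloorMulTau 0 0
  floorMulτ-0 = inj₁ z≤n , (s≤s z≤n , s≤s z≤n)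

  fsum-map-3+ : ∀ J → fsum (map (3 +_) J) ≡ fsumFrom 1 J + (fsumFrom 1 J + fsumFrom 0 J)
  fsum-map-3+ J = trans (sym (fsumFrom-0 (map (3 +_) J))) (trans (fsumFrom-0-map-3+ J) (regroup (fsumFrom 1 J) (fsumFrom 0 J)))
    where
    regroup : ∀ a m → a + m + a ≡ a + (a + m)
    regroup = solve-∀

  -- f (2h + 1) = f 0 + f 2 + ⋯ + f (2h)
  evens : ℕ → List ℕ
  evens zero = [ 0 ]
  evens (suc h) = evens h ++ [ double (suc h) ]

  Linked-evens : ∀ h → Linked Gap (evens h) × All (_≤ double h) (evens h)
  Linked-evens zero = [-] , (z≤n ∷ [])
  Linked-evens (suc h) =
    let linked , bounded = Linked-evens h
    in Linked-++-gap linked (All.map (λ {x} p → subst (x + 2 ≤_) (+-comm (double h) 2) (+-monoˡ-≤ 2 p)) bounded) [-] ,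
       All.++⁺ (All.map (λ p → ≤-trans p (≤-trans (n≤1+n _) (n≤1+n _))) bounded) (≤-refl ∷ [])

  fsum-evens : ∀ h → fsum (evens h) ≡ fib (suc (double h))
  fsum-evens zero = refl
  fsum-evens (suc h) = trans (fsum-++ (evens h) [ double (suc h) ]) (trans (cong₂ _+_ (fsum-evens h) (+-identityʳ _)) (+-comm (fib (suc (double h))) _))

  evens≡0∷ : ∀ h → Σ (List ℕ) λ E → evens h ≡ 0 ∷ E
  evens≡0∷ zero = [] , refl
  evens≡0∷ (suc h) = let E , e = evens≡0∷ h in E ++ [ double (suc h) ] , cong (_++ [ double (suc h) ]) e

  Linked-++-below : ∀ {E i K} → Linked Gap E → All (_≤ i) E → Linked Gap (suc i ∷ K) → Linked Gap (E ++ K)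
  Linked-++-below {E} {K = []} linkedE _ _ = subst (Linked Gap) (sym (List.++-identityʳ E)) linkedE
  Linked-++-below {i = i} {K = _ ∷ _} linkedE boundedE (gap ∷ linked) =
    Linked-++-gap linkedE (All.map (λ p → ≤-trans (+-monoˡ-≤ 2 p) (≤-trans (+-monoˡ-≤ 2 (n≤1+n i)) gap)) boundedE) linked

  even-representation : ∀ m → 0 < m → Σ ℕ λ h → Σ (List ℕ) λ J → Linked Gap (double h ∷ J) × fsum (double h ∷ J) ≡ m
  even-representation m 0<m with zeckendorf-exists m
  ... | [] , (_ , refl) = ⊥-elim (n≮0 0<m)
  ... | k ∷ K , ((_ , linked) , sum≡) with parity-view k
  ...   | h , inj₁ refl = h , K , linked , sum≡
  ...   | h , inj₂ refl =
    let E , e = evens≡0∷ h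
        linkedE , boundedE = Linked-evens h
    in 0 , E ++ K ,
       subst (Linked Gap) (cong (_++ K) e) (Linked-++-below linkedE boundedE linked) ,
       trans (cong fsum (cong (_++ K) (sym e))) (trans (fsum-++ (evens h) K) (trans (cong (_+ fsum K) (fsum-evens h)) sum≡))

  CanonicalMu1⇒Wythoff : ∀ n → n ≡ 0 ⊎ CanonicalMu1 n → Wythoff n
  CanonicalMu1⇒Wythoff n (inj₁ refl) = 0 , 0 , 0 , floorMulτ-0 , IsFloorMulTau⇒IsFloorMulTau² 0 0 floorMulτ-0 , refl
  CanonicalMu1⇒Wythoff n (inj₂ canonical) =
    let h , R , ((I≥1 , linked) , sum≡) = CanonicalMu1-view canonical
        I = suc (double (suc h)) ∷ R
        I≥3 : All (3 ≤_) I
        I≥3 = s≤s (s≤s (s≤s z≤n)) ∷ Linked-gap-lower-bound (≤-trans (s≤s (s≤s (s≤s z≤n))) (m≤m+n (suc (double (suc h))) 2)) linked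
        J = map (_∸ 3) R
        m = fsumFrom 0 (double h ∷ J)
        a = fsumFrom 1 (double h ∷ J)
        floor-a = floorMulτ-fsum h J (Linked-gap-map-∸ 3 I≥3 linked)
    in m , a , a + m , floor-a , IsFloorMulTau⇒IsFloorMulTau² m a floor-a ,
       trans (sym sum≡) (trans (cong fsum (sym (map-+-∸ 3 I I≥3))) (fsum-map-3+ (double h ∷ J)))

  floor-sum⇒CanonicalMu1 : ∀ n m a → IsFloorMulTau m a → n ≡ a + (a + m) → n ≡ 0 ⊎ CanonicalMu1 n
  floor-sum⇒CanonicalMu1 n zero a floor-a n≡ = inj₁ (trans n≡ (cong (λ z → z + (z + 0)) (IsFloorMulTau-unique 0 {a} {0} floor-a floorMulτ-0)))
  floor-sum⇒CanonicalMu1 n (suc m) a floor-a n≡ =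
    let h , J , linked , sum≡ = even-representation (suc m) (s≤s z≤n)
        m≡ : fsumFrom 0 (double h ∷ J) ≡ suc m
        m≡ = trans (fsumFrom-0 (double h ∷ J)) sum≡
        a≡ : fsumFrom 1 (double h ∷ J) ≡ a
        a≡ = IsFloorMulTau-unique (suc m) (subst (λ z → IsFloorMulTau z (fsumFrom 1 (double h ∷ J))) m≡ (floorMulτ-fsum h J linked)) floor-a
        I = map (3 +_) (double h ∷ J)
        sum≡n : fsum I ≡ n
        sum≡n = trans (fsum-map-3+ (double h ∷ J)) (trans (cong₂ (λ x y → x + (x + y)) a≡ m≡) (sym n≡))
    in inj₂ (suc (double (suc h)) , (map (3 +_) J , ((All.map⁺ (All.universal (λ _ → s≤s z≤n) (double h ∷ J)) , Linked-gap-map-+ 3 linked) , sum≡n)) ,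
             odd⇒¬2∣ (suc h) , s≤s (s≤s (s≤s z≤n)))

  Wythoff⇒CanonicalMu1 : ∀ n → Wythoff n → n ≡ 0 ⊎ CanonicalMu1 n
  Wythoff⇒CanonicalMu1 n (m , a , b , floor-a , floor-b , n≡a+b) =
    let c , b≡c+m , floor-c = IsFloorMulTau²⇒IsFloorMulTau m b floor-b
    in floor-sum⇒CanonicalMu1 n m a floor-a
         (trans n≡a+b (cong (a +_) (trans b≡c+m (cong (_+ m) (IsFloorMulTau-unique m floor-c floor-a)))))

  essential⇔Wythoff : (n : ℕ) → Essential n ⇔ Wythoff n
  essential⇔Wythoff n = mk⇔
    (λ essential → CanonicalMu1⇒Wythoff n (essential⇒CanonicalMu1 n essential))
    (λ wythoff → CanonicalMu1⇒essential n (Wythoff⇒CanonicalMu1 n wythoff))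

open import Data.Nat using (ℕ; _≤_; _+_)
open import Data.Nat.Divisibility using (_∣_)
open import Data.Rational using (ℚ)
open import Data.List using (List; _∷_; map)
open import Data.List.Relation.Unary.All using (All)
open import Data.Product using (Σ; _×_; _,_)
open import Data.Sum using (_⊎_)
open import Relation.Nullary using (¬_)
open import Relation.Binary.PropositionalEquality using (_≡_)
open import Function.Bundles using (_⇔_)

theorem3p4 :
  -- (a) for γ = g₁ * ⋯ * g_s ∈ Γ with s ≥ 1 and c(γ) = c(g₁) × ⋯ × c(g_s),
  --     θ(γ) = f_{ε(c(γ))}
  ((g : ℚ) (gs : Γ) → All InUnitInterval (g ∷ gs) →
    (Bs : List (List ℕ)) → All 𝒜₁ Bs → map ⟨_⟩ Bs ≡ g ∷ gs →
    IsTheta (g ∷ gs) (fsum (ε Bs)))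
  ×
  -- (b) n essential ⇔ n = 0 or (μ₁(n) odd and μ₁(n) ≥ 3)
  ((n : ℕ) → Essential n ⇔ (n ≡ 0 ⊎ Σ ℕ (λ i → IsMu1 n i × ¬ (2 ∣ i) × 3 ≤ i)))
  ×
  -- (c) n essential ⇔ n = ⌊mτ⌋ + ⌊mτ²⌋ for some m ∈ ℕ
  ((n : ℕ) → Essential n ⇔
    Σ ℕ (λ m → Σ ℕ (λ a → Σ ℕ (λ b →
      IsFloorMulTau m a × IsFloorMulTau² m b × n ≡ a + b))))
theorem3p4 = Theta.θ≡fsum-ε , Theta.essential⇔CanonicalMu1 , Wythoff.essential⇔Wythoff
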